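{- For every integer $k\geq 1$, let $P_k(x,q)=\sum_{n\geq k}\sum_{\pi\in P_{n,k}}x^nq^{\mathrm{sumelements}(\pi)}$ and let $D_k(x)=\frac{d}{dq}P_k(x,q)\big|_{q=1}$, which is a rational function of $x$. Then, as a rational function of $y$, $$D_k(1/y)=\sum_{m=1}^{k}\left(\frac{a_{k,m}}{(y-m)^2}+\frac{b_{k,m}}{y-m}\right),$$ where $$a_{k,m}=\frac{(-1)^{k-m}(k-m)m(m+1)}{2(m-1)!(k-m)!},$$ $$b_{k,m}=\frac{(-1)^{k-m}\left(-\frac{k^3}{12}-\frac{k^2(m+1)}{4}+\frac{k(6m^2+21m+10)}{12}-\frac{3m^2}{2}-m+\sum_{i=1}^{k}\frac{i(i-1)}{2}\right)}{(m-1)!(k-m)!}.$$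
   Context: A set partition of $[n]$ with exactly $k$ blocks is a collection $\{B_1,\dots,B_k\}$ of nonempty pairwise disjoint subsets with union $[n]$, indexed so that $\min B_1<\cdots<\min B_k$; $P_{n,k}$ is the set of such partitions. A partition is identified with its canonical sequential form $\pi=\pi_1\cdots\pi_n$, where $i\in B_{\pi_i}$. An entry $\pi_i$ is a record if $\pi_i>\pi_j$ for all $j<i$; the records are the first occurrences of $1,\dots,k$. For $a\in[k]$, $\mathrm{sumelements}_a(\pi)$ is the sum of all entries of $\pi$ at positions strictly before the record $a$, and $\mathrm{sumelements}(\pi)=\sum_{a=1}^{k}\mathrm{sumelements}_a(\pi)$. -}

module Defs where

open import Data.Nat as ℕ using (ℕ; zero; suc; _∸_; _!; _≡ᵇ_; _<ᵇ_)
open import Data.Nat.Properties using (_!≢0)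
open import Data.Integer as ℤ using (ℤ; +_)
open import Data.Rational as ℚ using (ℚ; 0ℚ; 1ℚ; _+_; _*_; _-_; -_)
open import Data.Bool using (Bool; true; false; if_then_else_; _∧_)
open import Data.List as L using (List; []; _∷_; concatMap; filter; map; take; upTo; foldr)
open import Data.Nat.ListAction using (sum)
open import Relation.Nullary.Decidable using (Dec)
open import Relation.Binary.PropositionalEquality using (_≡_)

all : {A : Set} → (A → Bool) → List A → Bool
all p = foldr (λ x r → p x ∧ r) true

range1 : ℕ → List ℕ
range1 k = map suc (upTo k)

words : ℕ → ℕ → List (List ℕ)
words k zero    = [] ∷ []
words k (suc n) = concatMap (λ w → map (λ a → a ∷ w) (range1 k)) (words k n)

occurs : ℕ → List ℕ → Bool
occurs a []      = false
occurs a (b ∷ w) = if a ≡ᵇ b then true else occurs a w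

-- 0-based position of the first occurrence of a in w (i.e. the number of
-- entries strictly before it); only meaningful when a occurs in w
firstOcc : ℕ → List ℕ → ℕ
firstOcc a []      = 0
firstOcc a (b ∷ w) = if a ≡ᵇ b then 0 else suc (firstOcc a w)

-- w (a word over [k]) is the canonical form of a set partition with exactly
-- k blocks: block a = {i | w_i = a}; every block is nonempty and
-- min B_1 < min B_2 < … < min B_k.
isPartition : ℕ → List ℕ → Bool
isPartition k w =
  all (λ a → occurs a w) (range1 k) ∧
  all (λ a → firstOcc a w <ᵇ firstOcc (suc a) w) (range1 (k ∸ 1))

P : ℕ → ℕ → List (List ℕ)
P n k = filter (λ w → isPartition k w Data.Bool.≟ true) (words k n)
  where import Data.Bool

sumelementsAt : ℕ → List ℕ → ℕ
sumelementsAt a w = sum (take (firstOcc a w) w)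

sumelements : ℕ → List ℕ → ℕ
sumelements k w = sum (map (λ a → sumelementsAt a w) (range1 k))

Series : Set
Series = ℕ → ℚ

fromℕ : ℕ → ℚ
fromℕ n = + n ℚ./ 1

_^ℚ_ : ℚ → ℕ → ℚ
q ^ℚ zero  = 1ℚ
q ^ℚ suc n = q * (q ^ℚ n)

sumUpTo : ℕ → (ℕ → ℚ) → ℚ
sumUpTo zero    f = f 0
sumUpTo (suc n) f = sumUpTo n f + f (suc n)

sum1 : ℕ → (ℕ → ℚ) → ℚ
sum1 zero    f = 0ℚ
sum1 (suc k) f = sum1 k f + f (suc k)

_⊕_ : Series → Series → Series
(f ⊕ g) n = f n + g n

_⊛_ : Series → Series → Series
(f ⊛ g) n = sumUpTo n (λ i → f i * g (n ∸ i))

_•_ : ℚ → Series → Series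
(c • f) n = c * f n

zeroS : Series
zeroS n = 0ℚ

sumS : ℕ → (ℕ → Series) → Series
sumS zero    F = zeroS
sumS (suc k) F = sumS k F ⊕ F (suc k)

X : Series
X 1 = 1ℚ
X _ = 0ℚ

-- 1/(1 - m x) = Σ_n m^n x^n  (the inverse of 1 - m x in ℚ[[x]])
geom : ℕ → Series
geom m n = fromℕ m ^ℚ n

-- with x = 1/y:  1/(y-m) = x/(1-mx),   1/(y-m)^2 = x^2/(1-mx)^2
invYminus : ℕ → Series
invYminus m = X ⊛ geom m

invYminusSq : ℕ → Series
invYminusSq m = (X ⊛ X) ⊛ (geom m ⊛ geom m)

-- D_k(x) = d/dq P_k(x,q) |_{q=1} = Σ_n x^n Σ_{π ∈ P_{n,k}} sumelements(π)

D : ℕ → Series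
D k n = fromℕ (sum (map (sumelements k) (P n k)))

invFact : ℕ → ℚ
invFact n = ℚ._/_ (+ 1) (n !) {{n !≢0}}

sign : ℕ → ℚ
sign zero    = 1ℚ
sign (suc n) = - sign n

half : ℚ
half = + 1 ℚ./ 2

a : ℕ → ℕ → ℚ
a k m = sign (k ∸ m) * fromℕ (k ∸ m) * fromℕ m * fromℕ (suc m)
        * half * invFact (m ∸ 1) * invFact (k ∸ m)

b : ℕ → ℕ → ℚ
b k m = sign (k ∸ m) * inner * invFact (m ∸ 1) * invFact (k ∸ m)
  where
    K M : ℚ
    K = fromℕ k
    M = fromℕ m
    inner : ℚ
    inner = - (K ^ℚ 3 * (+ 1 ℚ./ 12))
            - (K ^ℚ 2 * (M + 1ℚ) * (+ 1 ℚ./ 4))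
            + (K * (fromℕ 6 * M ^ℚ 2 + fromℕ 21 * M + fromℕ 10) * (+ 1 ℚ./ 12))
            - (fromℕ 3 * M ^ℚ 2 * half)
            - M
            + sum1 k (λ i → fromℕ i * (fromℕ i - 1ℚ) * half)

RHS : ℕ → Series
RHS k = sumS k (λ m → (a k m • invYminusSq m) ⊕ (b k m • invYminus m))

{-# OPTIONS --safe #-}
-- Splitting off the last letter of a partition gives recurrences in n of the form
-- u (n+1) k = k · u n k + (terms at k - 1) for the number S n k of partitions, the total sum
-- of their entries, and the total of sumelements.  The coefficient of x^n in
-- Σ_m α_m/(y-m)² + β_m/(y-m) (x = 1/y) satisfies such a recurrence exactly when the coefficients
-- obey a first-order recurrence in k; for a_{k,m}, b_{k,m} (and for the analogous closed forms
-- of the two simpler statistics) this reduces, through (m - k) · w_k(m) = w_{k-1}(m) for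
-- w_k(m) = (-1)^(k-m)/((m-1)!(k-m)!), to polynomial identities.  The initial values come from
-- Σ_m w_k(m) p(m) = Δ^(k-1) p (1)/(k-1)!, which vanishes when deg p < k - 1.
module Submission where

open import Defs
open import Data.Nat as ℕ using (ℕ; zero; suc; _≤_; _<_; z≤n; s≤s; _∸_; _!; _≥_)
import Data.Nat.Properties as ℕₚ
open import Data.Nat.Properties using (_!≢0)
open import Relation.Binary.PropositionalEquality using (_≡_; refl; sym; trans; cong; cong₂; module ≡-Reasoning)

-- Counting partitions by their last letter

module Partitions where

  open import Data.Nat using (_+_; _*_; _≡ᵇ_; _<ᵇ_)
  open import Data.Nat.ListAction using (sum)
  open import Data.Nat.ListAction.Properties using (sum-++)
  open import Data.Nat.Tactic.RingSolver using (solve-∀)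
  open import Data.Bool using (Bool; true; false; if_then_else_; _∧_; _∨_)
  import Data.Bool.Properties as Boolₚ
  open import Data.List using (List; []; _∷_; _++_; _∷ʳ_; map; take; length; concatMap; filter)
  import Data.List.Properties as Listₚ
  open import Data.Empty using (⊥-elim)
  open import Data.Sum using (inj₁; inj₂)
  open import Function using (_∘_; Equivalence)
  open import Relation.Binary.PropositionalEquality using (_≢_; subst; subst₂)
  open ≡-Reasoning

  sum1ℕ : ℕ → (ℕ → ℕ) → ℕ
  sum1ℕ zero    f = 0
  sum1ℕ (suc k) f = sum1ℕ k f + f (suc k)

  sum1ℕ-cong : ∀ k {f g : ℕ → ℕ} → (∀ c → 1 ≤ c → c ≤ k → f c ≡ g c) → sum1ℕ k f ≡ sum1ℕ k g
  sum1ℕ-cong zero    f≡g = refl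
  sum1ℕ-cong (suc k) f≡g =
    cong₂ _+_ (sum1ℕ-cong k (λ c 1≤c c≤k → f≡g c 1≤c (ℕₚ.m≤n⇒m≤1+n c≤k))) (f≡g (suc k) (s≤s z≤n) ℕₚ.≤-refl)

  sum1ℕ-+ : ∀ k (f g : ℕ → ℕ) → sum1ℕ k (λ c → f c + g c) ≡ sum1ℕ k f + sum1ℕ k g
  sum1ℕ-+ zero    f g = refl
  sum1ℕ-+ (suc k) f g =
    trans (cong (_+ (f (suc k) + g (suc k))) (sum1ℕ-+ k f g)) (interchange (sum1ℕ k f) (sum1ℕ k g) (f (suc k)) (g (suc k)))
    where
    interchange : ∀ x y u v → (x + y) + (u + v) ≡ (x + u) + (y + v)
    interchange = solve-∀

  sum1ℕ-0 : ∀ k → sum1ℕ k (λ _ → 0) ≡ 0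
  sum1ℕ-0 zero    = refl
  sum1ℕ-0 (suc k) = cong (_+ 0) (sum1ℕ-0 k)

  sum1ℕ-const : ∀ k x → sum1ℕ k (λ _ → x) ≡ k * x
  sum1ℕ-const zero    x = refl
  sum1ℕ-const (suc k) x = trans (cong (_+ x) (sum1ℕ-const k x)) (ℕₚ.+-comm (k * x) x)

  sum1ℕ-comm : ∀ k l (f : ℕ → ℕ → ℕ) → sum1ℕ k (λ y → sum1ℕ l (λ x → f x y)) ≡ sum1ℕ l (λ x → sum1ℕ k (λ y → f x y))
  sum1ℕ-comm zero    l f = sym (sum1ℕ-0 l)
  sum1ℕ-comm (suc k) l f =
    trans (cong (_+ sum1ℕ l (λ x → f x (suc k))) (sum1ℕ-comm k l f)) (sym (sum1ℕ-+ l _ (λ x → f x (suc k))))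

  ≡ᵇ-refl : ∀ n → (n ≡ᵇ n) ≡ true
  ≡ᵇ-refl zero    = refl
  ≡ᵇ-refl (suc n) = ≡ᵇ-refl n

  ≢⇒≡ᵇ-false : ∀ {m n} → m ≢ n → (m ≡ᵇ n) ≡ false
  ≢⇒≡ᵇ-false {m} {n} m≢n with m ≡ᵇ n in eq
  ... | false = refl
  ... | true  = ⊥-elim (m≢n (ℕₚ.≡ᵇ⇒≡ m n (Equivalence.from Boolₚ.T-≡ eq)))

  sum1ℕ-last : ∀ j (f : ℕ → ℕ) → sum1ℕ (suc j) (λ x → if x ≡ᵇ suc j then f x else 0) ≡ f (suc j)
  sum1ℕ-last j f = begin
    sum1ℕ j (λ x → if x ≡ᵇ suc j then f x else 0) + (if suc j ≡ᵇ suc j then f (suc j) else 0)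
      ≡⟨ cong₂ _+_ (sum1ℕ-cong j (λ x _ x≤j → cong (λ b → if b then f x else 0) (≢⇒≡ᵇ-false (ℕₚ.<⇒≢ (s≤s x≤j)))))
                   (cong (λ b → if b then f (suc j) else 0) (≡ᵇ-refl j)) ⟩
    sum1ℕ j (λ _ → 0) + f (suc j)
      ≡⟨ cong (_+ f (suc j)) (sum1ℕ-0 j) ⟩
    f (suc j) ∎

  private variable A B : Set

  ΣL : List A → (A → ℕ) → ℕ
  ΣL xs f = sum (map f xs)

  ΣL-cong : ∀ xs {f g : A → ℕ} → (∀ x → f x ≡ g x) → ΣL xs f ≡ ΣL xs g
  ΣL-cong xs f≡g = cong sum (Listₚ.map-cong f≡g xs)

  ΣL-+ : ∀ xs (f g : A → ℕ) → ΣL xs (λ x → f x + g x) ≡ ΣL xs f + ΣL xs g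
  ΣL-+ []       f g = refl
  ΣL-+ (x ∷ xs) f g =
    trans (cong (f x + g x +_) (ΣL-+ xs f g)) (interchange (f x) (g x) (ΣL xs f) (ΣL xs g))
    where
    interchange : ∀ x y u v → (x + y) + (u + v) ≡ (x + u) + (y + v)
    interchange = solve-∀

  ΣL-*ˡ : ∀ xs c (f : A → ℕ) → ΣL xs (λ x → c * f x) ≡ c * ΣL xs f
  ΣL-*ˡ []       c f = sym (ℕₚ.*-zeroʳ c)
  ΣL-*ˡ (x ∷ xs) c f = trans (cong (c * f x +_) (ΣL-*ˡ xs c f)) (sym (ℕₚ.*-distribˡ-+ c (f x) (ΣL xs f)))

  ΣL-0 : ∀ (xs : List A) → ΣL xs (λ _ → 0) ≡ 0
  ΣL-0 []       = refl
  ΣL-0 (x ∷ xs) = ΣL-0 xs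

  ΣL-++ : ∀ xs ys (f : A → ℕ) → ΣL (xs ++ ys) f ≡ ΣL xs f + ΣL ys f
  ΣL-++ xs ys f = trans (cong sum (Listₚ.map-++ f xs ys)) (sum-++ (map f xs) (map f ys))

  ΣL-concatMap : ∀ xs (F : A → List B) (g : B → ℕ) → ΣL (concatMap F xs) g ≡ ΣL xs (λ x → ΣL (F x) g)
  ΣL-concatMap []       F g = refl
  ΣL-concatMap (x ∷ xs) F g = trans (ΣL-++ (F x) (concatMap F xs) g) (cong (ΣL (F x) g +_) (ΣL-concatMap xs F g))

  ΣL-map : ∀ xs (h : A → B) (g : B → ℕ) → ΣL (map h xs) g ≡ ΣL xs (g ∘ h)
  ΣL-map xs h g = cong sum (sym (Listₚ.map-∘ xs))

  ΣL-filter : ∀ (p : A → Bool) xs (f : A → ℕ) →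
              ΣL (filter (λ x → p x Data.Bool.≟ true) xs) f ≡ ΣL xs (λ x → if p x then f x else 0)
  ΣL-filter p []       f = refl
  ΣL-filter p (x ∷ xs) f with p x
  ... | true  = cong (f x +_) (ΣL-filter p xs f)
  ... | false = ΣL-filter p xs f

  range1-suc : ∀ k → range1 (suc k) ≡ range1 k ∷ʳ suc k
  range1-suc k = trans (cong (map suc) (sym (Listₚ.upTo-∷ʳ k))) (Listₚ.map-++ suc (Data.List.upTo k) (k ∷ []))

  ΣL-range1 : ∀ k (f : ℕ → ℕ) → ΣL (range1 k) f ≡ sum1ℕ k f
  ΣL-range1 zero    f = refl
  ΣL-range1 (suc k) f = begin
    ΣL (range1 (suc k)) f               ≡⟨ cong (λ xs → ΣL xs f) (range1-suc k) ⟩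
    ΣL (range1 k ∷ʳ suc k) f            ≡⟨ ΣL-++ (range1 k) (suc k ∷ []) f ⟩
    ΣL (range1 k) f + (f (suc k) + 0)   ≡⟨ cong₂ _+_ (ΣL-range1 k f) (ℕₚ.+-identityʳ (f (suc k))) ⟩
    sum1ℕ k f + f (suc k)               ∎

  Σwords-∷ : ∀ k n (g : List ℕ → ℕ) → ΣL (words k (suc n)) g ≡ ΣL (words k n) (λ w → sum1ℕ k (λ x → g (x ∷ w)))
  Σwords-∷ k n g = trans (ΣL-concatMap (words k n) _ g) (ΣL-cong (words k n) (λ w →
    trans (ΣL-map (range1 k) (_∷ w) g) (ΣL-range1 k (λ x → g (x ∷ w)))))

  Σwords-∷ʳ : ∀ k n (g : List ℕ → ℕ) → ΣL (words k (suc n)) g ≡ ΣL (words k n) (λ w → sum1ℕ k (λ x → g (w ∷ʳ x)))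
  Σwords-∷ʳ k zero    g = Σwords-∷ k zero g
  Σwords-∷ʳ k (suc n) g = begin
    ΣL (words k (suc (suc n))) g
      ≡⟨ Σwords-∷ k (suc n) g ⟩
    ΣL (words k (suc n)) (λ w → sum1ℕ k (λ x → g (x ∷ w)))
      ≡⟨ Σwords-∷ʳ k n _ ⟩
    ΣL (words k n) (λ v → sum1ℕ k (λ y → sum1ℕ k (λ x → g (x ∷ v ∷ʳ y))))
      ≡⟨ ΣL-cong (words k n) (λ v → sum1ℕ-comm k k (λ x y → g (x ∷ v ∷ʳ y))) ⟩
    ΣL (words k n) (λ v → sum1ℕ k (λ x → sum1ℕ k (λ y → g (x ∷ v ∷ʳ y))))
      ≡⟨ Σwords-∷ k n _ ⟨
    ΣL (words k (suc n)) (λ w → sum1ℕ k (λ y → g (w ∷ʳ y))) ∎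

  Σwords-fresh : ∀ j n (g : List ℕ → ℕ) →
    ΣL (words (suc j) n) (λ w → if occurs (suc j) w then 0 else g w) ≡ ΣL (words j n) g
  Σwords-fresh j zero    g = refl
  Σwords-fresh j (suc n) g = begin
    ΣL (words (suc j) (suc n)) (λ w → if occurs (suc j) w then 0 else g w)
      ≡⟨ Σwords-∷ (suc j) n _ ⟩
    ΣL (words (suc j) n) (λ w → sum1ℕ (suc j) (λ x → if occurs (suc j) (x ∷ w) then 0 else g (x ∷ w)))
      ≡⟨ ΣL-cong (words (suc j) n) last-letter ⟩
    ΣL (words (suc j) n) (λ w → if occurs (suc j) w then 0 else sum1ℕ j (λ x → g (x ∷ w)))
      ≡⟨ Σwords-fresh j n _ ⟩
    ΣL (words j n) (λ w → sum1ℕ j (λ x → g (x ∷ w)))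
      ≡⟨ Σwords-∷ j n g ⟨
    ΣL (words j (suc n)) g ∎
    where
    avoid : ∀ b f → sum1ℕ j (λ x → if b then 0 else f x) ≡ (if b then 0 else sum1ℕ j f)
    avoid true  f = sum1ℕ-0 j
    avoid false f = refl
    last-letter : ∀ w → sum1ℕ (suc j) (λ x → if occurs (suc j) (x ∷ w) then 0 else g (x ∷ w)) ≡
                        (if occurs (suc j) w then 0 else sum1ℕ j (λ x → g (x ∷ w)))
    last-letter w = begin
      sum1ℕ j F + F (suc j)
        ≡⟨ cong₂ _+_ (sum1ℕ-cong j (λ x _ x≤j → cong (λ b → if (if b then true else o) then 0 else g (x ∷ w))
                                                         (≢⇒≡ᵇ-false (ℕₚ.>⇒≢ (s≤s x≤j)))))
                     (cong (λ b → if (if b then true else o) then 0 else g (suc j ∷ w)) (≡ᵇ-refl j)) ⟩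
      sum1ℕ j (λ x → if o then 0 else g (x ∷ w)) + 0
        ≡⟨ ℕₚ.+-identityʳ _ ⟩
      sum1ℕ j (λ x → if o then 0 else g (x ∷ w))
        ≡⟨ avoid o (λ x → g (x ∷ w)) ⟩
      (if o then 0 else sum1ℕ j (λ x → g (x ∷ w))) ∎
      where
      o = occurs (suc j) w
      F : ℕ → ℕ
      F x = if occurs (suc j) (x ∷ w) then 0 else g (x ∷ w)

  all-++ : ∀ (p : ℕ → Bool) xs ys → all p (xs ++ ys) ≡ all p xs ∧ all p ys
  all-++ p []       ys = refl
  all-++ p (x ∷ xs) ys = trans (cong (p x ∧_) (all-++ p xs ys)) (sym (Boolₚ.∧-assoc (p x) (all p xs) (all p ys)))

  all-range1-suc : ∀ (p : ℕ → Bool) k → all p (range1 (suc k)) ≡ all p (range1 k) ∧ p (suc k)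
  all-range1-suc p k = begin
    all p (range1 (suc k))                 ≡⟨ cong (all p) (range1-suc k) ⟩
    all p (range1 k ∷ʳ suc k)              ≡⟨ all-++ p (range1 k) (suc k ∷ []) ⟩
    all p (range1 k) ∧ (p (suc k) ∧ true)  ≡⟨ cong (all p (range1 k) ∧_) (Boolₚ.∧-identityʳ (p (suc k))) ⟩
    all p (range1 k) ∧ p (suc k)           ∎

  all-range1⁺ : ∀ (p : ℕ → Bool) k → (∀ c → 1 ≤ c → c ≤ k → p c ≡ true) → all p (range1 k) ≡ true
  all-range1⁺ p zero    pc = refl
  all-range1⁺ p (suc k) pc = trans (all-range1-suc p k)
    (cong₂ _∧_ (all-range1⁺ p k (λ c 1≤c c≤k → pc c 1≤c (ℕₚ.m≤n⇒m≤1+n c≤k))) (pc (suc k) (s≤s z≤n) ℕₚ.≤-refl))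

  all-range1⁻ : ∀ (p : ℕ → Bool) k → all p (range1 k) ≡ true → ∀ c → 1 ≤ c → c ≤ k → p c ≡ true
  all-range1⁻ p zero    _    _ (s≤s _) ()
  all-range1⁻ p (suc k) all≡ c 1≤c c≤1+k with ℕₚ.m≤n⇒m<n∨m≡n c≤1+k
  ... | inj₁ (s≤s c≤k) = all-range1⁻ p k (Boolₚ.∧-conicalˡ _ _ (trans (sym (all-range1-suc p k)) all≡)) c 1≤c c≤k
  ... | inj₂ refl      = Boolₚ.∧-conicalʳ _ _ (trans (sym (all-range1-suc p k)) all≡)

  all-range1-cong : ∀ (p q : ℕ → Bool) k → (∀ c → 1 ≤ c → c ≤ k → p c ≡ q c) → all p (range1 k) ≡ all q (range1 k)
  all-range1-cong p q zero    p≡q = refl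
  all-range1-cong p q (suc k) p≡q = begin
    all p (range1 (suc k))         ≡⟨ all-range1-suc p k ⟩
    all p (range1 k) ∧ p (suc k)   ≡⟨ cong₂ _∧_ (all-range1-cong p q k (λ c 1≤c c≤k → p≡q c 1≤c (ℕₚ.m≤n⇒m≤1+n c≤k)))
                                                (p≡q (suc k) (s≤s z≤n) ℕₚ.≤-refl) ⟩
    all q (range1 k) ∧ q (suc k)   ≡⟨ all-range1-suc q k ⟨
    all q (range1 (suc k))         ∎

  occurs-∷ʳ : ∀ c w x → occurs c (w ∷ʳ x) ≡ occurs c w ∨ (c ≡ᵇ x)
  occurs-∷ʳ c []      x with c ≡ᵇ x
  ... | true  = refl
  ... | false = refl
  occurs-∷ʳ c (y ∷ w) x with c ≡ᵇ y
  ... | true  = refl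
  ... | false = occurs-∷ʳ c w x

  firstOcc-∷ʳ : ∀ c w x → occurs c w ≡ true → firstOcc c (w ∷ʳ x) ≡ firstOcc c w
  firstOcc-∷ʳ c (y ∷ w) x c∈w with c ≡ᵇ y
  ... | true  = refl
  ... | false = cong suc (firstOcc-∷ʳ c w x c∈w)

  firstOcc<length : ∀ c w → occurs c w ≡ true → firstOcc c w < length w
  firstOcc<length c (y ∷ w) c∈w with c ≡ᵇ y
  ... | true  = s≤s z≤n
  ... | false = s≤s (firstOcc<length c w c∈w)

  length≤firstOcc-∷ʳ : ∀ c w x → occurs c w ≡ false → length w ≤ firstOcc c (w ∷ʳ x)
  length≤firstOcc-∷ʳ c []      x c∉w = z≤n
  length≤firstOcc-∷ʳ c (y ∷ w) x c∉w with c ≡ᵇ y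
  ... | false = s≤s (length≤firstOcc-∷ʳ c w x c∉w)

  firstOcc-∷ʳ-fresh : ∀ c w → occurs c w ≡ false → firstOcc c (w ∷ʳ c) ≡ length w
  firstOcc-∷ʳ-fresh c []      c∉w rewrite ≡ᵇ-refl c = refl
  firstOcc-∷ʳ-fresh c (y ∷ w) c∉w with c ≡ᵇ y
  ... | false = cong suc (firstOcc-∷ʳ-fresh c w c∉w)

  sumelementsAt-∷ʳ : ∀ c w x → occurs c w ≡ true → sumelementsAt c (w ∷ʳ x) ≡ sumelementsAt c w
  sumelementsAt-∷ʳ c w x c∈w = cong sum (prefix w c∈w)
    where
    prefix : ∀ w → occurs c w ≡ true → take (firstOcc c (w ∷ʳ x)) (w ∷ʳ x) ≡ take (firstOcc c w) w
    prefix (y ∷ w) c∈w with c ≡ᵇ y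
    ... | true  = refl
    ... | false = cong (y ∷_) (prefix w c∈w)

  sumelementsAt-∷ʳ-fresh : ∀ c w → occurs c w ≡ false → sumelementsAt c (w ∷ʳ c) ≡ sum w
  sumelementsAt-∷ʳ-fresh c w c∉w = cong sum (prefix w c∉w)
    where
    prefix : ∀ w → occurs c w ≡ false → take (firstOcc c (w ∷ʳ c)) (w ∷ʳ c) ≡ w
    prefix []      c∉w rewrite ≡ᵇ-refl c = refl
    prefix (y ∷ w) c∉w with c ≡ᵇ y
    ... | false = cong (y ∷_) (prefix w c∉w)

  <⇒<ᵇ≡true : ∀ {m n} → m < n → (m <ᵇ n) ≡ true
  <⇒<ᵇ≡true m<n = Equivalence.to Boolₚ.T-≡ (ℕₚ.<⇒<ᵇ m<n)

  <ᵇ≡true⇒< : ∀ {m n} → (m <ᵇ n) ≡ true → m < n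
  <ᵇ≡true⇒< {m} {n} m<ᵇn = ℕₚ.<ᵇ⇒< m n (Equivalence.from Boolₚ.T-≡ m<ᵇn)

  -- isPartition (suc j) w unfolds to allOccur (suc j) w ∧ recordsOrdered j w.
  allOccur : ℕ → List ℕ → Bool
  allOccur k w = all (λ c → occurs c w) (range1 k)

  recordsOrdered : ℕ → List ℕ → Bool
  recordsOrdered j w = all (λ c → firstOcc c w <ᵇ firstOcc (suc c) w) (range1 j)

  partition⇒occurs : ∀ k w → isPartition k w ≡ true → ∀ c → 1 ≤ c → c ≤ k → occurs c w ≡ true
  partition⇒occurs k w part = all-range1⁻ _ k (Boolₚ.∧-conicalˡ _ _ part)

  records-monotone : ∀ j v → recordsOrdered j v ≡ true → ∀ c → 1 ≤ c → c ≤ suc j → firstOcc c v ≤ firstOcc (suc j) v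
  records-monotone zero    v _ (suc zero)    _ _               = ℕₚ.≤-refl
  records-monotone zero    v _ (suc (suc c)) _ (s≤s ())
  records-monotone (suc i) v ordered c 1≤c c≤2+i with ℕₚ.m≤n⇒m<n∨m≡n c≤2+i
  ... | inj₂ refl      = ℕₚ.≤-refl
  ... | inj₁ (s≤s c≤1+i) = ℕₚ.≤-trans (records-monotone i v (Boolₚ.∧-conicalˡ _ _ ordered′) c 1≤c c≤1+i)
                                      (ℕₚ.<⇒≤ (<ᵇ≡true⇒< (Boolₚ.∧-conicalʳ _ _ ordered′)))
    where
    ordered′ : recordsOrdered i v ∧ (firstOcc (suc i) v <ᵇ firstOcc (suc (suc i)) v) ≡ true
    ordered′ = trans (sym (all-range1-suc _ i)) ordered

  isPartition-∷ʳ : ∀ j w x → (∀ c → 1 ≤ c → c ≤ suc j → occurs c w ≡ true) →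
                   isPartition (suc j) (w ∷ʳ x) ≡ isPartition (suc j) w
  isPartition-∷ʳ j w x occ = cong₂ _∧_
    (trans (all-range1⁺ _ (suc j) (λ c 1≤c c≤k → trans (occurs-∷ʳ c w x) (cong (_∨ (c ≡ᵇ x)) (occ c 1≤c c≤k))))
           (sym (all-range1⁺ _ (suc j) occ)))
    (all-range1-cong _ _ j (λ c 1≤c c≤j →
      cong₂ _<ᵇ_ (firstOcc-∷ʳ c w x (occ c 1≤c (ℕₚ.m≤n⇒m≤1+n c≤j))) (firstOcc-∷ʳ (suc c) w x (occ (suc c) (s≤s z≤n) (s≤s c≤j)))))

  -- A letter c ≤ k missing from w would first occur in w ∷ʳ x after k does, against the order of the records.
  isPartition-∷ʳ⁻ : ∀ j w x → isPartition (suc j) (w ∷ʳ x) ≡ true → occurs (suc j) w ≡ true → isPartition (suc j) w ≡ true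
  isPartition-∷ʳ⁻ j w x partition k∈w = trans (sym (isPartition-∷ʳ j w x occ)) partition
    where
    occ : ∀ c → 1 ≤ c → c ≤ suc j → occurs c w ≡ true
    occ c 1≤c c≤k with occurs c w in c∉w
    ... | true  = refl
    ... | false = ⊥-elim (ℕₚ.<⇒≱ (firstOcc<length (suc j) w k∈w) (subst (length w ≤_) (firstOcc-∷ʳ (suc j) w x k∈w)
                     (ℕₚ.≤-trans (length≤firstOcc-∷ʳ c w x c∉w)
                                 (records-monotone j (w ∷ʳ x) (Boolₚ.∧-conicalʳ _ _ partition) c 1≤c c≤k))))

  ∧-congˡ-true : ∀ x {y z} → (x ≡ true → y ≡ z) → x ∧ y ≡ x ∧ z
  ∧-congˡ-true true  y≡z = y≡z refl
  ∧-congˡ-true false y≡z = refl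

  recordsOrdered-∷ʳ-record : ∀ j w → occurs (suc j) w ≡ false → allOccur j w ≡ true →
                             recordsOrdered j (w ∷ʳ suc j) ≡ recordsOrdered (j ∸ 1) w
  recordsOrdered-∷ʳ-record zero    w _   _   = refl
  recordsOrdered-∷ʳ-record (suc i) w k∉w occ = begin
    recordsOrdered (suc i) v
      ≡⟨ all-range1-suc _ i ⟩
    recordsOrdered i v ∧ (firstOcc (suc i) v <ᵇ firstOcc (suc (suc i)) v)
      ≡⟨ cong₂ _∧_ (all-range1-cong _ _ i (λ c 1≤c c≤i →
                      cong₂ _<ᵇ_ (firstOcc-∷ʳ c w _ (c∈w c 1≤c (ℕₚ.m≤n⇒m≤1+n c≤i)))
                                 (firstOcc-∷ʳ (suc c) w _ (c∈w (suc c) (s≤s z≤n) (s≤s c≤i)))))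
                   (<⇒<ᵇ≡true last-record) ⟩
    recordsOrdered i w ∧ true
      ≡⟨ Boolₚ.∧-identityʳ (recordsOrdered i w) ⟩
    recordsOrdered i w ∎
    where
    v = w ∷ʳ suc (suc i)
    c∈w : ∀ c → 1 ≤ c → c ≤ suc i → occurs c w ≡ true
    c∈w = all-range1⁻ _ (suc i) occ
    last-record : firstOcc (suc i) v < firstOcc (suc (suc i)) v
    last-record = subst₂ _<_ (sym (firstOcc-∷ʳ (suc i) w _ (c∈w (suc i) (s≤s z≤n) ℕₚ.≤-refl)))
                             (sym (firstOcc-∷ʳ-fresh (suc (suc i)) w k∉w))
                             (firstOcc<length (suc i) w (c∈w (suc i) (s≤s z≤n) ℕₚ.≤-refl))

  isPartition-∷ʳ-record : ∀ j w → occurs (suc j) w ≡ false → isPartition (suc j) (w ∷ʳ suc j) ≡ isPartition j w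
  isPartition-∷ʳ-record j w k∉w = begin
    allOccur (suc j) v ∧ recordsOrdered j v
      ≡⟨ cong (_∧ recordsOrdered j v) occur ⟩
    allOccur j w ∧ recordsOrdered j v
      ≡⟨ ∧-congˡ-true (allOccur j w) (recordsOrdered-∷ʳ-record j w k∉w) ⟩
    allOccur j w ∧ recordsOrdered (j ∸ 1) w ∎
    where
    v = w ∷ʳ suc j
    k∈v : occurs (suc j) v ≡ true
    k∈v = trans (occurs-∷ʳ (suc j) w (suc j)) (cong₂ _∨_ k∉w (≡ᵇ-refl j))
    occur : allOccur (suc j) v ≡ allOccur j w
    occur = begin
      allOccur (suc j) v                ≡⟨ all-range1-suc _ j ⟩
      allOccur j v ∧ occurs (suc j) v   ≡⟨ cong (allOccur j v ∧_) k∈v ⟩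
      allOccur j v ∧ true               ≡⟨ Boolₚ.∧-identityʳ (allOccur j v) ⟩
      allOccur j v                      ≡⟨ all-range1-cong _ _ j (λ c _ c≤j → trans (occurs-∷ʳ c w (suc j))
                                             (trans (cong (occurs c w ∨_) (≢⇒≡ᵇ-false (ℕₚ.<⇒≢ (s≤s c≤j))))
                                                    (Boolₚ.∨-identityʳ (occurs c w)))) ⟩
      allOccur j w                      ∎

  isPartition-∷ʳ-fresh : ∀ j w x → occurs (suc j) w ≡ false →
                         isPartition (suc j) (w ∷ʳ x) ≡ (x ≡ᵇ suc j) ∧ isPartition j w
  isPartition-∷ʳ-fresh j w x k∉w with x ≡ᵇ suc j in x≡ᵇk
  ... | true with ℕₚ.≡ᵇ⇒≡ x (suc j) (Equivalence.from Boolₚ.T-≡ x≡ᵇk)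
  ...   | refl = isPartition-∷ʳ-record j w k∉w
  isPartition-∷ʳ-fresh j w x k∉w | false = cong (_∧ recordsOrdered j (w ∷ʳ x)) (begin
    allOccur (suc j) (w ∷ʳ x)                        ≡⟨ all-range1-suc _ j ⟩
    allOccur j (w ∷ʳ x) ∧ occurs (suc j) (w ∷ʳ x)    ≡⟨ cong (allOccur j (w ∷ʳ x) ∧_) k∉v ⟩
    allOccur j (w ∷ʳ x) ∧ false                      ≡⟨ Boolₚ.∧-zeroʳ (allOccur j (w ∷ʳ x)) ⟩
    false                                            ∎)
    where
    k≢x : suc j ≢ x
    k≢x refl with trans (sym (≡ᵇ-refl j)) x≡ᵇk
    ... | ()
    k∉v : occurs (suc j) (w ∷ʳ x) ≡ false
    k∉v = trans (occurs-∷ʳ (suc j) w x) (cong₂ _∨_ k∉w (≢⇒≡ᵇ-false k≢x))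

  ΣP : ℕ → ℕ → (List ℕ → ℕ) → ℕ
  ΣP n k f = ΣL (words k n) (λ w → if isPartition k w then f w else 0)

  D-ΣP : ∀ k n → D k n ≡ fromℕ (ΣP n k (sumelements k))
  D-ΣP k n = cong fromℕ (ΣL-filter (isPartition k) (words k n) (sumelements k))

  module _ (n k : ℕ) where

    ΣP-+ : ∀ (f g : List ℕ → ℕ) → ΣP n k (λ w → f w + g w) ≡ ΣP n k f + ΣP n k g
    ΣP-+ f g = trans (ΣL-cong (words k n) pointwise) (ΣL-+ (words k n) _ _)
      where
      pointwise : ∀ w → (if isPartition k w then f w + g w else 0) ≡
                        (if isPartition k w then f w else 0) + (if isPartition k w then g w else 0)
      pointwise w with isPartition k w
      ... | true  = refl
      ... | false = refl

    ΣP-*ˡ : ∀ c (f : List ℕ → ℕ) → ΣP n k (λ w → c * f w) ≡ c * ΣP n k f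
    ΣP-*ˡ c f = trans (ΣL-cong (words k n) pointwise) (ΣL-*ˡ (words k n) c _)
      where
      pointwise : ∀ w → (if isPartition k w then c * f w else 0) ≡ c * (if isPartition k w then f w else 0)
      pointwise w with isPartition k w
      ... | true  = refl
      ... | false = sym (ℕₚ.*-zeroʳ c)

  ΣP-no-blocks : ∀ n f → ΣP (suc n) 0 f ≡ 0
  ΣP-no-blocks n f = trans (Σwords-∷ 0 n _) (ΣL-0 (words 0 n))

  sum-last-letter : ∀ j w {f g h : List ℕ → ℕ} →
    (isPartition (suc j) w ≡ true → sum1ℕ (suc j) (λ x → f (w ∷ʳ x)) ≡ g w) →
    (isPartition j w ≡ true → occurs (suc j) w ≡ false → f (w ∷ʳ suc j) ≡ h w) →
    sum1ℕ (suc j) (λ x → if isPartition (suc j) (w ∷ʳ x) then f (w ∷ʳ x) else 0) ≡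
    (if isPartition (suc j) w then g w else 0) + (if occurs (suc j) w then 0 else (if isPartition j w then h w else 0))
  sum-last-letter j w {f} {g} {h} extend new-block with isPartition (suc j) w in part
  ... | true = begin
    sum1ℕ k (λ x → if isPartition k (w ∷ʳ x) then f (w ∷ʳ x) else 0)
      ≡⟨ sum1ℕ-cong k (λ x _ _ → cong (λ b → if b then f (w ∷ʳ x) else 0) (trans (isPartition-∷ʳ j w x occ) part)) ⟩
    sum1ℕ k (λ x → f (w ∷ʳ x))
      ≡⟨ extend refl ⟩
    g w
      ≡⟨ ℕₚ.+-identityʳ (g w) ⟨
    g w + 0
      ≡⟨ cong (λ b → g w + (if b then 0 else (if isPartition j w then h w else 0))) (occ k (s≤s z≤n) ℕₚ.≤-refl) ⟨
    g w + (if occurs k w then 0 else (if isPartition j w then h w else 0)) ∎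
    where
    k = suc j
    occ : ∀ c → 1 ≤ c → c ≤ k → occurs c w ≡ true
    occ = partition⇒occurs k w part
  ... | false with occurs (suc j) w in k-occurs
  ...   | true = trans (sum1ℕ-cong (suc j) (λ x _ _ → cong (λ b → if b then f (w ∷ʳ x) else 0) (not-partition x)))
                       (sum1ℕ-0 (suc j))
    where
    not-partition : ∀ x → isPartition (suc j) (w ∷ʳ x) ≡ false
    not-partition x with isPartition (suc j) (w ∷ʳ x) in part′
    ... | false = refl
    ... | true with trans (sym (isPartition-∷ʳ⁻ j w x part′ k-occurs)) part
    ...   | ()
  ...   | false = begin
    sum1ℕ (suc j) (λ x → if isPartition (suc j) (w ∷ʳ x) then f (w ∷ʳ x) else 0)
      ≡⟨ sum1ℕ-cong (suc j) (λ x _ _ → cong (λ b → if b then f (w ∷ʳ x) else 0) (isPartition-∷ʳ-fresh j w x k-occurs)) ⟩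
    sum1ℕ (suc j) (λ x → if (x ≡ᵇ suc j) ∧ isPartition j w then f (w ∷ʳ x) else 0)
      ≡⟨ new-record (isPartition j w) refl ⟩
    (if isPartition j w then h w else 0) ∎
    where
    new-record : ∀ b → isPartition j w ≡ b →
      sum1ℕ (suc j) (λ x → if (x ≡ᵇ suc j) ∧ b then f (w ∷ʳ x) else 0) ≡ (if b then h w else 0)
    new-record true  part′ = trans (sum1ℕ-cong (suc j) (λ x _ _ →
                                     cong (λ c → if c then f (w ∷ʳ x) else 0) (Boolₚ.∧-identityʳ (x ≡ᵇ suc j))))
                                   (trans (sum1ℕ-last j (λ x → f (w ∷ʳ x))) (new-block part′ refl))
    new-record false _     = trans (sum1ℕ-cong (suc j) (λ x _ _ →
                                     cong (λ c → if c then f (w ∷ʳ x) else 0) (Boolₚ.∧-zeroʳ (x ≡ᵇ suc j))))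
                                   (sum1ℕ-0 (suc j))

  -- w ∷ʳ x has k blocks iff w has k blocks, or w has k - 1 blocks and x = k opens the last one.
  ΣP-∷ʳ : ∀ j n {f g h : List ℕ → ℕ} →
    (∀ w → isPartition (suc j) w ≡ true → sum1ℕ (suc j) (λ x → f (w ∷ʳ x)) ≡ g w) →
    (∀ w → isPartition j w ≡ true → occurs (suc j) w ≡ false → f (w ∷ʳ suc j) ≡ h w) →
    ΣP (suc n) (suc j) f ≡ ΣP n (suc j) g + ΣP n j h
  ΣP-∷ʳ j n {f} {g} {h} extend new-block = begin
    ΣP (suc n) k f
      ≡⟨ Σwords-∷ʳ k n _ ⟩
    ΣL (words k n) (λ w → sum1ℕ k (λ x → if isPartition k (w ∷ʳ x) then f (w ∷ʳ x) else 0))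
      ≡⟨ ΣL-cong (words k n) (λ w → sum-last-letter j w {f} {g} {h} (extend w) (new-block w)) ⟩
    ΣL (words k n) (λ w → (if isPartition k w then g w else 0) + fresh w)
      ≡⟨ ΣL-+ (words k n) _ fresh ⟩
    ΣP n k g + ΣL (words k n) fresh
      ≡⟨ cong (ΣP n k g +_) (Σwords-fresh j n _) ⟩
    ΣP n k g + ΣP n j h ∎
    where
    k = suc j
    fresh : List ℕ → ℕ
    fresh w = if occurs k w then 0 else (if isPartition j w then h w else 0)

  S : ℕ → ℕ → ℕ
  S n k = ΣP n k (λ _ → 1)

  entrySum : ℕ → ℕ → ℕ
  entrySum n k = ΣP n k sum

  sumelementsSum : ℕ → ℕ → ℕ
  sumelementsSum n k = ΣP n k (sumelements k)

  triangle : ℕ → ℕ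
  triangle k = sum1ℕ k (λ x → x)

  S-suc : ∀ n j → S (suc n) (suc j) ≡ suc j * S n (suc j) + S n j
  S-suc n j = trans (ΣP-∷ʳ j n (λ _ _ → sum1ℕ-const (suc j) 1) (λ _ _ _ → refl))
                    (cong (_+ S n j) (ΣP-*ˡ n (suc j) (suc j) (λ _ → 1)))

  entrySum-suc : ∀ n j → entrySum (suc n) (suc j) ≡
    suc j * entrySum n (suc j) + (triangle (suc j) * S n (suc j) + (entrySum n j + suc j * S n j))
  entrySum-suc n j = begin
    entrySum (suc n) k
      ≡⟨ ΣP-∷ʳ j n extend new-block ⟩
    ΣP n k (λ w → k * sum w + triangle k * 1) + ΣP n j (λ w → sum w + k * 1)
      ≡⟨ cong₂ _+_ (trans (ΣP-+ n k _ _) (cong₂ _+_ (ΣP-*ˡ n k k sum) (ΣP-*ˡ n k (triangle k) (λ _ → 1))))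
                   (trans (ΣP-+ n j _ _) (cong (entrySum n j +_) (ΣP-*ˡ n j k (λ _ → 1)))) ⟩
    (k * entrySum n k + triangle k * S n k) + (entrySum n j + k * S n j)
      ≡⟨ ℕₚ.+-assoc (k * entrySum n k) _ _ ⟩
    k * entrySum n k + (triangle k * S n k + (entrySum n j + k * S n j)) ∎
    where
    k = suc j
    sum-∷ʳ : ∀ w x → sum (w ∷ʳ x) ≡ sum w + x
    sum-∷ʳ w x = trans (sum-++ w (x ∷ [])) (cong (sum w +_) (ℕₚ.+-identityʳ x))
    extend : ∀ w → isPartition k w ≡ true → sum1ℕ k (λ x → sum (w ∷ʳ x)) ≡ k * sum w + triangle k * 1
    extend w _ = begin
      sum1ℕ k (λ x → sum (w ∷ʳ x))       ≡⟨ sum1ℕ-cong k (λ x _ _ → sum-∷ʳ w x) ⟩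
      sum1ℕ k (λ x → sum w + x)          ≡⟨ sum1ℕ-+ k _ (λ x → x) ⟩
      sum1ℕ k (λ _ → sum w) + triangle k ≡⟨ cong₂ _+_ (sum1ℕ-const k (sum w)) (sym (ℕₚ.*-identityʳ (triangle k))) ⟩
      k * sum w + triangle k * 1         ∎
    new-block : ∀ w → isPartition j w ≡ true → occurs k w ≡ false → sum (w ∷ʳ k) ≡ sum w + k * 1
    new-block w _ _ = trans (sum-∷ʳ w k) (cong (sum w +_) (sym (ℕₚ.*-identityʳ k)))

  sumelements-suc : ∀ j w → sumelements (suc j) w ≡ sumelements j w + sumelementsAt (suc j) w
  sumelements-suc j w = trans (ΣL-range1 (suc j) _) (cong (_+ sumelementsAt (suc j) w) (sym (ΣL-range1 j _)))

  sumelementsSum-suc : ∀ n j → sumelementsSum (suc n) (suc j) ≡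
    suc j * sumelementsSum n (suc j) + (sumelementsSum n j + entrySum n j)
  sumelementsSum-suc n j = begin
    sumelementsSum (suc n) k
      ≡⟨ ΣP-∷ʳ j n extend new-block ⟩
    ΣP n k (λ w → k * sumelements k w) + ΣP n j (λ w → sumelements j w + sum w)
      ≡⟨ cong₂ _+_ (ΣP-*ˡ n k k (sumelements k)) (ΣP-+ n j (sumelements j) sum) ⟩
    k * sumelementsSum n k + (sumelementsSum n j + entrySum n j) ∎
    where
    k = suc j
    extend : ∀ w → isPartition k w ≡ true → sum1ℕ k (λ x → sumelements k (w ∷ʳ x)) ≡ k * sumelements k w
    extend w part = trans (sum1ℕ-cong k (λ x _ _ → unchanged x)) (sum1ℕ-const k (sumelements k w))
      where
      unchanged : ∀ x → sumelements k (w ∷ʳ x) ≡ sumelements k w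
      unchanged x = trans (ΣL-range1 k _) (trans (sum1ℕ-cong k (λ c 1≤c c≤k → sumelementsAt-∷ʳ c w x (partition⇒occurs k w part c 1≤c c≤k)))
                                                  (sym (ΣL-range1 k _)))
    new-block : ∀ w → isPartition j w ≡ true → occurs k w ≡ false → sumelements k (w ∷ʳ k) ≡ sumelements j w + sum w
    new-block w part k∉w = begin
      sumelements k (w ∷ʳ k)                             ≡⟨ sumelements-suc j (w ∷ʳ k) ⟩
      sumelements j (w ∷ʳ k) + sumelementsAt k (w ∷ʳ k)   ≡⟨ cong₂ _+_ old-records (sumelementsAt-∷ʳ-fresh k w k∉w) ⟩
      sumelements j w + sum w                            ∎
      where
      old-records : sumelements j (w ∷ʳ k) ≡ sumelements j w
      old-records = trans (ΣL-range1 j _) (trans (sum1ℕ-cong j (λ c 1≤c c≤j → sumelementsAt-∷ʳ c w k (partition⇒occurs j w part c 1≤c c≤j)))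
                                                  (sym (ΣL-range1 j _)))

open Partitions using (S; entrySum; sumelementsSum; triangle; S-suc; entrySum-suc; sumelementsSum-suc; ΣP-no-blocks; D-ΣP)

import Data.Nat.Coprimality as Coprime
open import Data.Integer using (+_)
import Data.Integer as ℤ
import Data.Integer.Properties as ℤₚ
open import Data.Rational as ℚ using (ℚ; 0ℚ; 1ℚ; _+_; _*_; _-_; -_; mkℚ; 1/_; toℚᵘ)
import Data.Rational.Properties as ℚₚ
import Data.Rational.Unnormalised as ℚᵘ
import Data.Rational.Unnormalised.Properties as ℚᵘₚ
open import Relation.Nullary.Decidable using (dec⇒maybe)
open import Tactic.RingSolver using (solve-∀)
open import Tactic.RingSolver.Core.AlmostCommutativeRing using (AlmostCommutativeRing; fromCommutativeRing)

ℚ-ring : AlmostCommutativeRing _ _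
ℚ-ring = fromCommutativeRing ℚₚ.+-*-commutativeRing (λ x → dec⇒maybe (0ℚ ℚₚ.≟ x))

-- fromℕ n normalises by a gcd, so its additivity is proved on unnormalised rationals.
toℚᵘ-fromℕ : ∀ n → toℚᵘ (fromℕ n) ℚᵘ.≃ ℚᵘ.mkℚᵘ (+ n) 0
toℚᵘ-fromℕ n = ℚₚ.toℚᵘ-fromℚᵘ (ℚᵘ.mkℚᵘ (+ n) 0)

fromℕ-suc : ∀ n → fromℕ (suc n) ≡ 1ℚ + fromℕ n
fromℕ-suc n = ℚₚ.toℚᵘ-injective (begin
  toℚᵘ (fromℕ (suc n))              ≈⟨ toℚᵘ-fromℕ (suc n) ⟩
  ℚᵘ.mkℚᵘ (+ suc n) 0               ≈⟨ ℚᵘ.*≡* (cong (λ z → (+ 1 ℤ.+ z) ℤ.* + 1) (sym (ℤₚ.*-identityʳ (+ n)))) ⟩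
  ℚᵘ.1ℚᵘ ℚᵘ.+ ℚᵘ.mkℚᵘ (+ n) 0       ≈⟨ ℚᵘₚ.+-congʳ ℚᵘ.1ℚᵘ (ℚᵘₚ.≃-sym (toℚᵘ-fromℕ n)) ⟩
  toℚᵘ 1ℚ ℚᵘ.+ toℚᵘ (fromℕ n)       ≈⟨ ℚₚ.toℚᵘ-homo-+ 1ℚ (fromℕ n) ⟨
  toℚᵘ (1ℚ + fromℕ n)               ∎)
  where
  open ℚᵘₚ.≃-Reasoning

open ≡-Reasoning

fromℕ-+ : ∀ m n → fromℕ (m ℕ.+ n) ≡ fromℕ m + fromℕ n
fromℕ-+ zero    n = sym (ℚₚ.+-identityˡ (fromℕ n))
fromℕ-+ (suc m) n = begin
  fromℕ (suc (m ℕ.+ n))     ≡⟨ fromℕ-suc (m ℕ.+ n) ⟩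
  1ℚ + fromℕ (m ℕ.+ n)      ≡⟨ cong (λ z → 1ℚ + z) (fromℕ-+ m n) ⟩
  1ℚ + (fromℕ m + fromℕ n)  ≡⟨ ℚₚ.+-assoc 1ℚ (fromℕ m) (fromℕ n) ⟨
  (1ℚ + fromℕ m) + fromℕ n  ≡⟨ cong (_+ fromℕ n) (fromℕ-suc m) ⟨
  fromℕ (suc m) + fromℕ n   ∎

fromℕ-* : ∀ m n → fromℕ (m ℕ.* n) ≡ fromℕ m * fromℕ n
fromℕ-* zero    n = sym (ℚₚ.*-zeroˡ (fromℕ n))
fromℕ-* (suc m) n = begin
  fromℕ (n ℕ.+ m ℕ.* n)            ≡⟨ fromℕ-+ n (m ℕ.* n) ⟩
  fromℕ n + fromℕ (m ℕ.* n)        ≡⟨ cong (λ z → fromℕ n + z) (fromℕ-* m n) ⟩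
  fromℕ n + fromℕ m * fromℕ n      ≡⟨ expand (fromℕ m) (fromℕ n) ⟨
  (1ℚ + fromℕ m) * fromℕ n         ≡⟨ cong (_* fromℕ n) (fromℕ-suc m) ⟨
  fromℕ (suc m) * fromℕ n          ∎
  where
  expand : ∀ x y → (1ℚ + x) * y ≡ y + x * y
  expand = solve-∀ ℚ-ring

fromℕ-*-+ : ∀ x y z → fromℕ (x ℕ.* y ℕ.+ z) ≡ fromℕ x * fromℕ y + fromℕ z
fromℕ-*-+ x y z = trans (fromℕ-+ (x ℕ.* y) z) (cong (_+ fromℕ z) (fromℕ-* x y))

fromℕ-∸ : ∀ m n → n ≤ m → fromℕ (m ∸ n) ≡ fromℕ m - fromℕ n
fromℕ-∸ m n n≤m = begin
  fromℕ (m ∸ n)                        ≡⟨ add-sub (fromℕ (m ∸ n)) (fromℕ n) ⟨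
  (fromℕ (m ∸ n) + fromℕ n) - fromℕ n  ≡⟨ cong (_- fromℕ n) (fromℕ-+ (m ∸ n) n) ⟨
  fromℕ (m ∸ n ℕ.+ n) - fromℕ n        ≡⟨ cong (λ z → fromℕ z - fromℕ n) (ℕₚ.m∸n+n≡m n≤m) ⟩
  fromℕ m - fromℕ n                    ∎
  where
  add-sub : ∀ x y → (x + y) - y ≡ x
  add-sub = solve-∀ ℚ-ring

recip-fromℕ : ∀ d .{{_ : ℕ.NonZero d}} → (+ 1 ℚ./ d) * fromℕ d ≡ 1ℚ
recip-fromℕ (suc d) = begin
  (+ 1 ℚ./ suc d) * fromℕ (suc d)  ≡⟨ cong₂ _*_ (ℚₚ.normalize-coprime 1⊥d) (ℚₚ.normalize-coprime d⊥1) ⟩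
  1/ q * q                          ≡⟨ ℚₚ.*-inverseˡ q ⟩
  1ℚ                                ∎
  where
  1⊥d : Coprime.Coprime 1 (suc d)
  1⊥d = Coprime.1-coprimeTo (suc d)
  d⊥1 : Coprime.Coprime (suc d) 1
  d⊥1 = Coprime.sym 1⊥d
  q = mkℚ (+ suc d) 0 d⊥1

fromℕ-suc-cancelˡ : ∀ j {x} → fromℕ (suc j) * x ≡ 0ℚ → x ≡ 0ℚ
fromℕ-suc-cancelˡ j {x} jx≡0 = begin
  x                   ≡⟨ ℚₚ.*-identityˡ x ⟨
  1ℚ * x              ≡⟨ cong (_* x) (recip-fromℕ (suc j)) ⟨
  (r * fromℕ (suc j)) * x ≡⟨ ℚₚ.*-assoc r (fromℕ (suc j)) x ⟩
  r * (fromℕ (suc j) * x) ≡⟨ cong (r *_) jx≡0 ⟩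
  r * 0ℚ              ≡⟨ ℚₚ.*-zeroʳ r ⟩
  0ℚ                  ∎
  where r = + 1 ℚ./ suc j

invFact-suc : ∀ t → invFact (suc t) * fromℕ (suc t) ≡ invFact t
invFact-suc t = begin
  x * F                  ≡⟨ ℚₚ.*-identityʳ (x * F) ⟨
  (x * F) * 1ℚ           ≡⟨ cong ((x * F) *_) (recip-fromℕ (t !) {{t !≢0}}) ⟨
  (x * F) * (y * f)      ≡⟨ regroup x F y f ⟩
  (x * (F * f)) * y      ≡⟨ cong (λ z → (x * z) * y) (fromℕ-* (suc t) (t !)) ⟨
  (x * fromℕ (suc t !)) * y ≡⟨ cong (_* y) (recip-fromℕ (suc t !) {{suc t !≢0}}) ⟩
  1ℚ * y                 ≡⟨ ℚₚ.*-identityˡ y ⟩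
  y                      ∎
  where
  x = invFact (suc t)
  y = invFact t
  F = fromℕ (suc t)
  f = fromℕ (t !)
  regroup : ∀ x F y f → (x * F) * (y * f) ≡ (x * (F * f)) * y
  regroup = solve-∀ ℚ-ring

sum1-cong : ∀ k {f g : ℕ → ℚ} → (∀ m → 1 ≤ m → m ≤ k → f m ≡ g m) → sum1 k f ≡ sum1 k g
sum1-cong zero    f≡g = refl
sum1-cong (suc k) f≡g =
  cong₂ _+_ (sum1-cong k (λ m 1≤m m≤k → f≡g m 1≤m (ℕₚ.m≤n⇒m≤1+n m≤k))) (f≡g (suc k) (s≤s z≤n) ℕₚ.≤-refl)

sum1-+ : ∀ k (f g : ℕ → ℚ) → sum1 k (λ m → f m + g m) ≡ sum1 k f + sum1 k g
sum1-+ zero    f g = refl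
sum1-+ (suc k) f g = trans (cong (_+ (f (suc k) + g (suc k))) (sum1-+ k f g)) (interchange (sum1 k f) (sum1 k g) (f (suc k)) (g (suc k)))
  where
  interchange : ∀ x y u v → (x + y) + (u + v) ≡ (x + u) + (y + v)
  interchange = solve-∀ ℚ-ring

sum1-- : ∀ k (f g : ℕ → ℚ) → sum1 k (λ m → f m - g m) ≡ sum1 k f - sum1 k g
sum1-- zero    f g = refl
sum1-- (suc k) f g = trans (cong (_+ (f (suc k) - g (suc k))) (sum1-- k f g)) (interchange (sum1 k f) (sum1 k g) (f (suc k)) (g (suc k)))
  where
  interchange : ∀ x y u v → (x - y) + (u - v) ≡ (x + u) - (y + v)
  interchange = solve-∀ ℚ-ring

sum1-*ˡ : ∀ k c (f : ℕ → ℚ) → sum1 k (λ m → c * f m) ≡ c * sum1 k f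
sum1-*ˡ zero    c f = sym (ℚₚ.*-zeroʳ c)
sum1-*ˡ (suc k) c f = trans (cong (_+ c * f (suc k)) (sum1-*ˡ k c f)) (sym (ℚₚ.*-distribˡ-+ c (sum1 k f) (f (suc k))))

sum1-suc : ∀ k (f : ℕ → ℚ) → sum1 (suc k) f ≡ f 1 + sum1 k (λ m → f (suc m))
sum1-suc zero    f = ℚₚ.+-comm 0ℚ (f 1)
sum1-suc (suc k) f = trans (cong (_+ f (suc (suc k))) (sum1-suc k f)) (ℚₚ.+-assoc (f 1) _ _)

-- Weighted sums and finite differences

-- weight k m = (-1)^(k-m)/((m-1)!(k-m)!), and S (n+1) k = Σ_m weight k m · m^n.
weight : ℕ → ℕ → ℚ
weight k m = sign (k ∸ m) * invFact (m ∸ 1) * invFact (k ∸ m)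

weight-top : ∀ j m → m ≤ j → (fromℕ m - fromℕ (suc j)) * weight (suc j) m ≡ weight j m
weight-top j m m≤j = begin
  (M - fromℕ (suc j)) * weight (suc j) m
    ≡⟨ cong (λ z → (M - fromℕ (suc j)) * (sign z * i * invFact z)) (ℕₚ.+-∸-assoc 1 m≤j) ⟩
  (M - fromℕ (suc j)) * (- sign t * i * invFact (suc t))
    ≡⟨ flip-sign M (fromℕ (suc j)) (sign t) i (invFact (suc t)) ⟩
  sign t * i * (invFact (suc t) * (fromℕ (suc j) - M))
    ≡⟨ cong (λ z → sign t * i * (invFact (suc t) * z)) distance ⟨
  sign t * i * (invFact (suc t) * fromℕ (suc t))
    ≡⟨ cong (λ z → sign t * i * z) (invFact-suc t) ⟩
  weight j m ∎
  where
  t = j ∸ m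
  M = fromℕ m
  i = invFact (m ∸ 1)
  distance : fromℕ (suc t) ≡ fromℕ (suc j) - M
  distance = trans (cong fromℕ (sym (ℕₚ.+-∸-assoc 1 m≤j))) (fromℕ-∸ (suc j) m (ℕₚ.m≤n⇒m≤1+n m≤j))
  flip-sign : ∀ M K s i x → (M - K) * (- s * i * x) ≡ s * i * (x * (K - M))
  flip-sign = solve-∀ ℚ-ring

weight-bottom : ∀ j p → fromℕ (suc p) * weight (suc j) (suc (suc p)) ≡ weight j (suc p)
weight-bottom j p = begin
  F * (s * invFact (suc p) * i)  ≡⟨ reorder F s (invFact (suc p)) i ⟩
  s * (invFact (suc p) * F) * i  ≡⟨ cong (λ z → s * z * i) (invFact-suc p) ⟩
  s * invFact p * i              ∎
  where
  F = fromℕ (suc p)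
  s = sign (j ∸ suc p)
  i = invFact (j ∸ suc p)
  reorder : ∀ F s x i → F * (s * x * i) ≡ s * (x * F) * i
  reorder = solve-∀ ℚ-ring

weighted : ℕ → (ℕ → ℚ) → ℚ
weighted k f = sum1 k (λ m → weight k m * f m)

weighted-cong : ∀ k {f g : ℕ → ℚ} → (∀ m → 1 ≤ m → m ≤ k → f m ≡ g m) → weighted k f ≡ weighted k g
weighted-cong k f≡g = sum1-cong k (λ m 1≤m m≤k → cong (weight k m *_) (f≡g m 1≤m m≤k))

weighted-*ˡ : ∀ k c (f : ℕ → ℚ) → weighted k (λ m → c * f m) ≡ c * weighted k f
weighted-*ˡ k c f = trans (sum1-cong k (λ m _ _ → swap (weight k m) c (f m))) (sum1-*ˡ k c _)
  where
  swap : ∀ w c x → w * (c * x) ≡ c * (w * x)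
  swap = solve-∀ ℚ-ring

weighted-- : ∀ k (f g : ℕ → ℚ) → weighted k (λ m → f m - g m) ≡ weighted k f - weighted k g
weighted-- k f g = trans (sum1-cong k (λ m _ _ → distrib (weight k m) (f m) (g m))) (sum1-- k _ _)
  where
  distrib : ∀ w x y → w * (x - y) ≡ w * x - w * y
  distrib = solve-∀ ℚ-ring

weighted-top : ∀ j (f : ℕ → ℚ) → weighted (suc j) (λ m → (fromℕ m - fromℕ (suc j)) * f m) ≡ weighted j f
weighted-top j f = begin
  sum1 j (λ m → weight (suc j) m * ((fromℕ m - K) * f m)) + weight (suc j) (suc j) * ((K - K) * f (suc j))
    ≡⟨ cong₂ _+_ (sum1-cong j (λ m _ m≤j → trans (assoc (weight (suc j) m) (fromℕ m - K) (f m)) (cong (_* f m) (weight-top j m m≤j))))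
                 (vanish (weight (suc j) (suc j)) K (f (suc j))) ⟩
  weighted j f + 0ℚ
    ≡⟨ ℚₚ.+-identityʳ (weighted j f) ⟩
  weighted j f ∎
  where
  K = fromℕ (suc j)
  assoc : ∀ w d x → w * (d * x) ≡ (d * w) * x
  assoc = solve-∀ ℚ-ring
  vanish : ∀ w K x → w * ((K - K) * x) ≡ 0ℚ
  vanish = solve-∀ ℚ-ring

weighted-bottom : ∀ j (f : ℕ → ℚ) → weighted (suc j) (λ m → (fromℕ m - 1ℚ) * f m) ≡ weighted j (λ m → f (suc m))
weighted-bottom j f = begin
  weighted (suc j) (λ m → (fromℕ m - 1ℚ) * f m)
    ≡⟨ sum1-suc j _ ⟩
  weight (suc j) 1 * (0ℚ * f 1) + sum1 j (λ m → weight (suc j) (suc m) * ((fromℕ (suc m) - 1ℚ) * f (suc m)))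
    ≡⟨ cong₂ _+_ (vanish (weight (suc j) 1) (f 1)) (sum1-cong j shift) ⟩
  0ℚ + weighted j (λ m → f (suc m))
    ≡⟨ ℚₚ.+-identityˡ _ ⟩
  weighted j (λ m → f (suc m)) ∎
  where
  vanish : ∀ w x → w * (0ℚ * x) ≡ 0ℚ
  vanish = solve-∀ ℚ-ring
  rearrange : ∀ w M x → w * (((1ℚ + M) - 1ℚ) * x) ≡ (M * w) * x
  rearrange = solve-∀ ℚ-ring
  shift : ∀ m → 1 ≤ m → m ≤ j →
          weight (suc j) (suc m) * ((fromℕ (suc m) - 1ℚ) * f (suc m)) ≡ weight j m * f (suc m)
  shift (suc p) _ _ = begin
    weight (suc j) (suc (suc p)) * ((fromℕ (suc (suc p)) - 1ℚ) * f (suc (suc p)))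
      ≡⟨ cong (λ z → weight (suc j) (suc (suc p)) * ((z - 1ℚ) * f (suc (suc p)))) (fromℕ-suc (suc p)) ⟩
    weight (suc j) (suc (suc p)) * (((1ℚ + fromℕ (suc p)) - 1ℚ) * f (suc (suc p)))
      ≡⟨ rearrange (weight (suc j) (suc (suc p))) (fromℕ (suc p)) (f (suc (suc p))) ⟩
    (fromℕ (suc p) * weight (suc j) (suc (suc p))) * f (suc (suc p))
      ≡⟨ cong (_* f (suc (suc p))) (weight-bottom j p) ⟩
    weight j (suc p) * f (suc (suc p)) ∎

Δ : (ℕ → ℚ) → ℕ → ℚ
Δ f m = f (suc m) - f m

-- Iterated, this gives weighted k f = Δ^(k-1) f 1/(k-1)!.
weighted-Δ : ∀ j (f : ℕ → ℚ) → fromℕ j * weighted (suc j) f ≡ weighted j (Δ f)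
weighted-Δ j f = begin
  J * weighted (suc j) f
    ≡⟨ weighted-*ˡ (suc j) J f ⟨
  weighted (suc j) (λ m → J * f m)
    ≡⟨ weighted-cong (suc j) (λ m _ _ → split m) ⟩
  weighted (suc j) (λ m → (fromℕ m - 1ℚ) * f m - (fromℕ m - K) * f m)
    ≡⟨ weighted-- (suc j) _ _ ⟩
  weighted (suc j) (λ m → (fromℕ m - 1ℚ) * f m) - weighted (suc j) (λ m → (fromℕ m - K) * f m)
    ≡⟨ cong₂ _-_ (weighted-bottom j f) (weighted-top j f) ⟩
  weighted j (λ m → f (suc m)) - weighted j f
    ≡⟨ weighted-- j _ _ ⟨
  weighted j (Δ f) ∎
  where
  J = fromℕ j
  K = fromℕ (suc j)
  difference : ∀ M J x → J * x ≡ (M - 1ℚ) * x - (M - (1ℚ + J)) * x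
  difference = solve-∀ ℚ-ring
  split : ∀ m → J * f m ≡ (fromℕ m - 1ℚ) * f m - (fromℕ m - K) * f m
  split m = trans (difference (fromℕ m) J (f m)) (cong (λ z → (fromℕ m - 1ℚ) * f m - (fromℕ m - z) * f m) (sym (fromℕ-suc j)))

DegreeBelow : ℕ → (ℕ → ℚ) → Set
DegreeBelow zero    f = ∀ m → f m ≡ 0ℚ
DegreeBelow (suc d) f = DegreeBelow d (Δ f)

DegreeBelow-zero : ∀ d {f} → (∀ m → f m ≡ 0ℚ) → DegreeBelow d f
DegreeBelow-zero zero    f≡0 = f≡0
DegreeBelow-zero (suc d) f≡0 =
  DegreeBelow-zero d (λ m → trans (cong₂ _-_ (f≡0 (suc m)) (f≡0 m)) (ℚₚ.+-inverseʳ 0ℚ))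

DegreeBelow-weaken : ∀ {d d'} f → d ≤ d' → DegreeBelow d f → DegreeBelow d' f
DegreeBelow-weaken {d' = d'} f z≤n     f≡0 = DegreeBelow-zero d' f≡0
DegreeBelow-weaken           f (s≤s le) deg = DegreeBelow-weaken (Δ f) le deg

weighted-DegreeBelow : ∀ d f → DegreeBelow d f → weighted (suc d) f ≡ 0ℚ
weighted-DegreeBelow zero    f f≡0 = cong (λ z → 0ℚ + weight 1 1 * z) (f≡0 1)
weighted-DegreeBelow (suc d) f deg =
  fromℕ-suc-cancelˡ d (trans (weighted-Δ (suc d) f) (weighted-DegreeBelow d (Δ f) deg))

weighted-vanishes : ∀ {d} k f → d < k → DegreeBelow d f → weighted k f ≡ 0ℚ
weighted-vanishes (suc k) f (s≤s d≤k) deg = weighted-DegreeBelow k f (DegreeBelow-weaken f d≤k deg)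

quadratic-DegreeBelow : ∀ c₀ c₁ c₂ {f} → (∀ m → f m ≡ c₀ + c₁ * fromℕ m + c₂ * (fromℕ m * fromℕ m)) →
                        DegreeBelow 3 f
quadratic-DegreeBelow c₀ c₁ c₂ {f} f≡ m
  rewrite f≡ m | f≡ (suc m) | f≡ (suc (suc m)) | f≡ (suc (suc (suc m)))
        | fromℕ-suc (suc (suc m)) | fromℕ-suc (suc m) | fromℕ-suc m
  = third-difference c₀ c₁ c₂ (fromℕ m)
  where
  third-difference : ∀ c₀ c₁ c₂ M → let q = λ N → c₀ + c₁ * N + c₂ * (N * N) in
    ((q (1ℚ + (1ℚ + (1ℚ + M))) - q (1ℚ + (1ℚ + M))) - (q (1ℚ + (1ℚ + M)) - q (1ℚ + M)))
    - ((q (1ℚ + (1ℚ + M)) - q (1ℚ + M)) - (q (1ℚ + M) - q M)) ≡ 0ℚ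
  third-difference = solve-∀ ℚ-ring

-- Coefficients of 1/(y-m) and 1/(y-m)² in x = 1/y

sumUpTo-cong : ∀ n {f g : ℕ → ℚ} → (∀ i → i ≤ n → f i ≡ g i) → sumUpTo n f ≡ sumUpTo n g
sumUpTo-cong zero    f≡g = f≡g 0 z≤n
sumUpTo-cong (suc n) f≡g =
  cong₂ _+_ (sumUpTo-cong n (λ i i≤n → f≡g i (ℕₚ.m≤n⇒m≤1+n i≤n))) (f≡g (suc n) ℕₚ.≤-refl)

sumUpTo-suc : ∀ n (f : ℕ → ℚ) → sumUpTo (suc n) f ≡ f 0 + sumUpTo n (λ i → f (suc i))
sumUpTo-suc zero    f = refl
sumUpTo-suc (suc n) f = trans (cong (_+ f (suc (suc n))) (sumUpTo-suc n f)) (ℚₚ.+-assoc (f 0) _ _)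

sumUpTo-const : ∀ n c → sumUpTo n (λ _ → c) ≡ fromℕ (suc n) * c
sumUpTo-const zero    c = sym (ℚₚ.*-identityˡ c)
sumUpTo-const (suc n) c = begin
  sumUpTo n (λ _ → c) + c      ≡⟨ cong (_+ c) (sumUpTo-const n c) ⟩
  fromℕ (suc n) * c + c        ≡⟨ expand (fromℕ (suc n)) c ⟨
  (1ℚ + fromℕ (suc n)) * c     ≡⟨ cong (_* c) (fromℕ-suc (suc n)) ⟨
  fromℕ (suc (suc n)) * c      ∎
  where
  expand : ∀ x c → (1ℚ + x) * c ≡ x * c + c
  expand = solve-∀ ℚ-ring

X-⊛ : ∀ f n → (X ⊛ f) (suc n) ≡ f n
X-⊛ f n = picks-1 n (λ i → f (suc n ∸ i))
  where
  picks-1 : ∀ n (g : ℕ → ℚ) → sumUpTo (suc n) (λ i → X i * g i) ≡ g 1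
  picks-1 zero    g = trans (cong₂ _+_ (ℚₚ.*-zeroˡ (g 0)) (ℚₚ.*-identityˡ (g 1))) (ℚₚ.+-identityˡ (g 1))
  picks-1 (suc n) g = trans (cong₂ _+_ (picks-1 n g) (ℚₚ.*-zeroˡ (g (suc (suc n))))) (ℚₚ.+-identityʳ (g 1))

⊛-suc : ∀ f g n → f 0 ≡ 0ℚ → (f ⊛ g) (suc n) ≡ ((λ i → f (suc i)) ⊛ g) n
⊛-suc f g n f0≡0 = begin
  sumUpTo (suc n) (λ i → f i * g (suc n ∸ i))  ≡⟨ sumUpTo-suc n (λ i → f i * g (suc n ∸ i)) ⟩
  f 0 * g (suc n) + rest                       ≡⟨ cong (λ z → z * g (suc n) + rest) f0≡0 ⟩
  0ℚ * g (suc n) + rest                        ≡⟨ cong (_+ rest) (ℚₚ.*-zeroˡ (g (suc n))) ⟩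
  0ℚ + rest                                    ≡⟨ ℚₚ.+-identityˡ rest ⟩
  rest                                         ∎
  where rest = sumUpTo n (λ i → f (suc i) * g (n ∸ i))

pow-split : ∀ x i n → i ≤ n → (x ^ℚ i) * (x ^ℚ (n ∸ i)) ≡ x ^ℚ n
pow-split x zero    n       _         = ℚₚ.*-identityˡ (x ^ℚ n)
pow-split x (suc i) (suc n) (s≤s i≤n) = trans (ℚₚ.*-assoc x (x ^ℚ i) _) (cong (x *_) (pow-split x i n i≤n))

geom-⊛-geom : ∀ m n → (geom m ⊛ geom m) n ≡ fromℕ (suc n) * (fromℕ m ^ℚ n)
geom-⊛-geom m n = trans (sumUpTo-cong n (λ i i≤n → pow-split (fromℕ m) i n i≤n)) (sumUpTo-const n (fromℕ m ^ℚ n))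

invYminus-suc : ∀ m n → invYminus m (suc n) ≡ fromℕ m ^ℚ n
invYminus-suc m = X-⊛ (geom m)

invYminusSq-suc : ∀ m n → invYminusSq m (suc n) ≡ (X ⊛ (geom m ⊛ geom m)) n
invYminusSq-suc m n = trans (⊛-suc (X ⊛ X) G n refl) (sumUpTo-cong n (λ i _ → cong (_* G (n ∸ i)) (X-⊛ X i)))
  where G = geom m ⊛ geom m

invYminusSq-1 : ∀ m → invYminusSq m 1 ≡ 0ℚ
invYminusSq-1 m = trans (invYminusSq-suc m 0) (ℚₚ.*-zeroˡ ((geom m ⊛ geom m) 0))

invYminusSq-suc-suc : ∀ m n → invYminusSq m (suc (suc n)) ≡ fromℕ (suc n) * (fromℕ m ^ℚ n)
invYminusSq-suc-suc m n = trans (invYminusSq-suc m (suc n)) (trans (X-⊛ (geom m ⊛ geom m) n) (geom-⊛-geom m n))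

invYminus-step : ∀ m n → invYminus m (suc (suc n)) ≡ fromℕ m * invYminus m (suc n)
invYminus-step m n = trans (invYminus-suc m (suc n)) (cong (fromℕ m *_) (sym (invYminus-suc m n)))

invYminusSq-step : ∀ m n → invYminusSq m (suc (suc n)) ≡ fromℕ m * invYminusSq m (suc n) + invYminus m (suc n)
invYminusSq-step m zero = begin
  invYminusSq m 2                           ≡⟨ invYminusSq-suc-suc m 0 ⟩
  1ℚ                                        ≡⟨ absorb (fromℕ m) ⟨
  fromℕ m * 0ℚ + 1ℚ                         ≡⟨ cong₂ (λ u v → fromℕ m * u + v) (invYminusSq-1 m) (invYminus-suc m 0) ⟨
  fromℕ m * invYminusSq m 1 + invYminus m 1 ∎
  where
  absorb : ∀ M → M * 0ℚ + 1ℚ ≡ 1ℚ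
  absorb = solve-∀ ℚ-ring
invYminusSq-step m (suc n) = begin
  invYminusSq m (suc (suc (suc n)))          ≡⟨ invYminusSq-suc-suc m (suc n) ⟩
  fromℕ (suc (suc n)) * (M * M ^ℚ n)         ≡⟨ cong (_* (M * M ^ℚ n)) (fromℕ-suc (suc n)) ⟩
  (1ℚ + N) * (M * M ^ℚ n)                    ≡⟨ expand N M (M ^ℚ n) ⟩
  M * (N * M ^ℚ n) + M * M ^ℚ n              ≡⟨ cong₂ (λ u v → M * u + v) (invYminusSq-suc-suc m n) (invYminus-suc m (suc n)) ⟨
  M * invYminusSq m (suc (suc n)) + invYminus m (suc (suc n)) ∎
  where
  M = fromℕ m
  N = fromℕ (suc n)
  expand : ∀ N M P → (1ℚ + N) * (M * P) ≡ M * (N * P) + M * P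
  expand = solve-∀ ℚ-ring

sumS-apply : ∀ k (F : ℕ → Series) n → sumS k F n ≡ sum1 k (λ m → F m n)
sumS-apply zero    F n = refl
sumS-apply (suc k) F n = cong (_+ F (suc k) n) (sumS-apply k F n)

partialFractions : ℕ → (ℕ → ℚ) → (ℕ → ℚ) → Series
partialFractions k α β n = sum1 k (λ m → α m * invYminusSq m n + β m * invYminus m n)

RHS-partialFractions : ∀ k n → RHS k n ≡ partialFractions k (a k) (b k) n
RHS-partialFractions k = sumS-apply k _

module _ (k : ℕ) where

  partialFractions-cong : ∀ {α α' β β' : ℕ → ℚ} n →
    (∀ m → 1 ≤ m → m ≤ k → α m ≡ α' m) → (∀ m → 1 ≤ m → m ≤ k → β m ≡ β' m) →
    partialFractions k α β n ≡ partialFractions k α' β' n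
  partialFractions-cong n α≡ β≡ = sum1-cong k (λ m 1≤m m≤k →
    cong₂ (λ x y → x * invYminusSq m n + y * invYminus m n) (α≡ m 1≤m m≤k) (β≡ m 1≤m m≤k))

  partialFractions-+ : ∀ α β α' β' n →
    partialFractions k α β n + partialFractions k α' β' n ≡
    partialFractions k (λ m → α m + α' m) (λ m → β m + β' m) n
  partialFractions-+ α β α' β' n = trans (sym (sum1-+ k _ _)) (sum1-cong k (λ m _ _ →
    distrib (α m) (β m) (α' m) (β' m) (invYminusSq m n) (invYminus m n)))
    where
    distrib : ∀ x y x' y' A B → (x * A + y * B) + (x' * A + y' * B) ≡ (x + x') * A + (y + y') * B
    distrib = solve-∀ ℚ-ring

  partialFractions-*ˡ : ∀ c α β n →
    c * partialFractions k α β n ≡ partialFractions k (λ m → c * α m) (λ m → c * β m) n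
  partialFractions-*ˡ c α β n = trans (sym (sum1-*ˡ k c _)) (sum1-cong k (λ m _ _ →
    distrib c (α m) (β m) (invYminusSq m n) (invYminus m n)))
    where
    distrib : ∀ c x y A B → c * (x * A + y * B) ≡ (c * x) * A + (c * y) * B
    distrib = solve-∀ ℚ-ring

partialFractions-0 : ∀ k α β → partialFractions k α β 0 ≡ 0ℚ
partialFractions-0 zero    α β = refl
partialFractions-0 (suc k) α β =
  trans (cong (_+ (α (suc k) * 0ℚ + β (suc k) * 0ℚ)) (partialFractions-0 k α β)) (absorb (α (suc k)) (β (suc k)))
  where
  absorb : ∀ x y → 0ℚ + (x * 0ℚ + y * 0ℚ) ≡ 0ℚ
  absorb = solve-∀ ℚ-ring

partialFractions-1 : ∀ k α β → partialFractions k α β 1 ≡ sum1 k β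
partialFractions-1 k α β = sum1-cong k (λ m _ _ →
  trans (cong₂ (λ A B → α m * A + β m * B) (invYminusSq-1 m) (invYminus-suc m 0)) (absorb (α m) (β m)))
  where
  absorb : ∀ x y → x * 0ℚ + y * 1ℚ ≡ y
  absorb = solve-∀ ℚ-ring

-- (1 - K x) (α/(y-m)² + β/(y-m)) = x (stepα K α/(y-m)² + stepβ K α β/(y-m)) + x β.
stepα : ℚ → (ℕ → ℚ) → ℕ → ℚ
stepα K α m = (fromℕ m - K) * α m

stepβ : ℚ → (ℕ → ℚ) → (ℕ → ℚ) → ℕ → ℚ
stepβ K α β m = α m + (fromℕ m - K) * β m

partialFractions-step : ∀ k α β K n →
  partialFractions k α β (suc (suc n)) ≡
  K * partialFractions k α β (suc n) + partialFractions k (stepα K α) (stepβ K α β) (suc n)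
partialFractions-step k α β K n = begin
  partialFractions k α β (suc (suc n))
    ≡⟨ sum1-cong k (λ m _ _ → term m) ⟩
  sum1 k (λ m → K * (α m * A m + β m * B m) + (stepα K α m * A m + stepβ K α β m * B m))
    ≡⟨ sum1-+ k _ _ ⟩
  sum1 k (λ m → K * (α m * A m + β m * B m)) + shifted
    ≡⟨ cong (_+ shifted) (sum1-*ˡ k K (λ m → α m * A m + β m * B m)) ⟩
  K * partialFractions k α β (suc n) + shifted ∎
  where
  A B : ℕ → ℚ
  A m = invYminusSq m (suc n)
  B m = invYminus m (suc n)
  shifted : ℚ
  shifted = partialFractions k (stepα K α) (stepβ K α β) (suc n)
  regroup : ∀ x y M K A B → x * (M * A + B) + y * (M * B) ≡
                            K * (x * A + y * B) + ((M - K) * x * A + (x + (M - K) * y) * B)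
  regroup = solve-∀ ℚ-ring
  term : ∀ m → α m * invYminusSq m (suc (suc n)) + β m * invYminus m (suc (suc n)) ≡
               K * (α m * A m + β m * B m) + (stepα K α m * A m + stepβ K α β m * B m)
  term m = trans (cong₂ (λ u v → α m * u + β m * v) (invYminusSq-step m n) (invYminus-step m n))
                 (regroup (α m) (β m) (fromℕ m) K (A m) (B m))

partialFractions-extend : ∀ j α β n → α (suc j) ≡ 0ℚ → β (suc j) ≡ 0ℚ →
                          partialFractions (suc j) α β n ≡ partialFractions j α β n
partialFractions-extend j α β n α≡0 β≡0 =
  trans (cong₂ (λ x y → partialFractions j α β n + (x * invYminusSq (suc j) n + y * invYminus (suc j) n)) α≡0 β≡0)
        (absorb (partialFractions j α β n) (invYminusSq (suc j) n) (invYminus (suc j) n))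
  where
  absorb : ∀ x A B → x + (0ℚ * A + 0ℚ * B) ≡ x
  absorb = solve-∀ ℚ-ring

recurrence-partialFractions : ∀ K k α β {u w : ℕ → ℚ} →
  u 0 ≡ 0ℚ →
  (∀ n → u (suc n) ≡ K * u n + w n) →
  w 0 ≡ sum1 k β →
  (∀ n → w (suc n) ≡ partialFractions k (stepα K α) (stepβ K α β) (suc n)) →
  ∀ n → u n ≡ partialFractions k α β n
recurrence-partialFractions K k α β {u} {w} u0 rec w0 wₙ = solution
  where
  solution : ∀ n → u n ≡ partialFractions k α β n
  solution zero = trans u0 (sym (partialFractions-0 k α β))
  solution (suc zero) = begin
    u 1              ≡⟨ rec 0 ⟩
    K * u 0 + w 0    ≡⟨ cong₂ (λ x y → K * x + y) u0 w0 ⟩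
    K * 0ℚ + sum1 k β ≡⟨ cong (_+ sum1 k β) (ℚₚ.*-zeroʳ K) ⟩
    0ℚ + sum1 k β    ≡⟨ ℚₚ.+-identityˡ (sum1 k β) ⟩
    sum1 k β         ≡⟨ partialFractions-1 k α β ⟨
    partialFractions k α β 1 ∎
  solution (suc (suc n)) = begin
    u (suc (suc n))                   ≡⟨ rec (suc n) ⟩
    K * u (suc n) + w (suc n)         ≡⟨ cong₂ (λ x y → K * x + y) (solution (suc n)) (wₙ n) ⟩
    K * partialFractions k α β (suc n) + partialFractions k (stepα K α) (stepβ K α β) (suc n) ≡⟨ partialFractions-step k α β K n ⟨
    partialFractions k α β (suc (suc n)) ∎

quarter : ℚ
quarter = + 1 ℚ./ 4

bPoly : ℚ → ℚ → ℚ → ℚ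
bPoly K M S = - (K ^ℚ 3 * (+ 1 ℚ./ 12))
              - (K ^ℚ 2 * (M + 1ℚ) * (+ 1 ℚ./ 4))
              + (K * (fromℕ 6 * M ^ℚ 2 + fromℕ 21 * M + fromℕ 10) * (+ 1 ℚ./ 12))
              - (fromℕ 3 * M ^ℚ 2 * half)
              - M
              + S

pairSum : ℕ → ℚ
pairSum k = sum1 k (λ i → fromℕ i * (fromℕ i - 1ℚ) * half)

b-weight : ∀ k m → b k m ≡ weight k m * bPoly (fromℕ k) (fromℕ m) (pairSum k)
b-weight k m = reorder (sign (k ∸ m)) (bPoly (fromℕ k) (fromℕ m) (pairSum k)) (invFact (m ∸ 1)) (invFact (k ∸ m))
  where
  reorder : ∀ s x i j → s * x * i * j ≡ s * i * j * x
  reorder = solve-∀ ℚ-ring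

triangleℚ : ℚ → ℚ
triangleℚ M = M * (M + 1ℚ) * half

-- Not in the paper: entrySum (n+1) k = Σ_m weight k m (triangleℚ m · n m^(n-1) + entryPoly k m · m^n).
entryPoly : ℚ → ℚ → ℚ
entryPoly K M = (K * K - K + fromℕ 2) * quarter + (fromℕ 2 - K) * M * half

triangle-ℚ : ∀ k → fromℕ (triangle k) ≡ triangleℚ (fromℕ k)
triangle-ℚ zero    = refl
triangle-ℚ (suc k) = begin
  fromℕ (triangle k ℕ.+ suc k)               ≡⟨ fromℕ-+ (triangle k) (suc k) ⟩
  fromℕ (triangle k) + fromℕ (suc k)         ≡⟨ cong₂ _+_ (triangle-ℚ k) (fromℕ-suc k) ⟩
  triangleℚ (fromℕ k) + (1ℚ + fromℕ k)       ≡⟨ next (fromℕ k) ⟩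
  triangleℚ (1ℚ + fromℕ k)                   ≡⟨ cong triangleℚ (fromℕ-suc k) ⟨
  triangleℚ (fromℕ (suc k))                  ∎
  where
  next : ∀ K → K * (K + 1ℚ) * half + (1ℚ + K) ≡ (1ℚ + K) * ((1ℚ + K) + 1ℚ) * half
  next = solve-∀ ℚ-ring

a-weight : ∀ k m → m ≤ k → a k m ≡ weight k m * ((fromℕ k - fromℕ m) * triangleℚ (fromℕ m))
a-weight k m m≤k = trans
  (cong₂ (λ d M₁ → sign (k ∸ m) * d * fromℕ m * M₁ * half * invFact (m ∸ 1) * invFact (k ∸ m)) (fromℕ-∸ k m m≤k) (fromℕ-suc m))
  (reorder (sign (k ∸ m)) (fromℕ k) (fromℕ m) (invFact (m ∸ 1)) (invFact (k ∸ m)))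
  where
  reorder : ∀ s K M i j → s * (K - M) * M * (1ℚ + M) * half * i * j ≡ s * i * j * ((K - M) * (M * (M + 1ℚ) * half))
  reorder = solve-∀ ℚ-ring

a-diagonal : ∀ k → a k k ≡ 0ℚ
a-diagonal k = trans (a-weight k k ℕₚ.≤-refl) (vanish (weight k k) (fromℕ k))
  where
  vanish : ∀ e K → e * ((K - K) * (K * (K + 1ℚ) * half)) ≡ 0ℚ
  vanish = solve-∀ ℚ-ring

-- solve-∀ treats defined names as constants, so the identities below spell out their polynomials.
entryPoly-step : ∀ J {K} M e → K ≡ 1ℚ + J →
  triangleℚ K * e + ((M - K) * e * entryPoly J M + K * ((M - K) * e)) ≡ e * triangleℚ M + (M - K) * (e * entryPoly K M)
entryPoly-step J M e refl = identity J M e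
  where
  identity : ∀ J M e →
    let K = 1ℚ + J
        E = λ K M → (K * K - K + fromℕ 2) * quarter + (fromℕ 2 - K) * M * half
    in K * (K + 1ℚ) * half * e + ((M - K) * e * E J M + K * ((M - K) * e)) ≡
       e * (M * (M + 1ℚ) * half) + (M - K) * (e * E K M)
  identity = solve-∀ ℚ-ring

bPoly-step : ∀ J {K} M S → K ≡ 1ℚ + J →
  bPoly K M (S + K * (K - 1ℚ) * half) ≡ bPoly J M S + entryPoly J M + triangleℚ M
bPoly-step J M S refl = identity J M S
  where
  identity : ∀ J M S →
    let B = λ K M S → - (K * (K * (K * 1ℚ)) * (+ 1 ℚ./ 12)) - (K * (K * 1ℚ) * (M + 1ℚ) * (+ 1 ℚ./ 4))
                      + (K * (fromℕ 6 * (M * (M * 1ℚ)) + fromℕ 21 * M + fromℕ 10) * (+ 1 ℚ./ 12))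
                      - (fromℕ 3 * (M * (M * 1ℚ)) * half) - M + S
        K = 1ℚ + J
    in B K M (S + K * (K - 1ℚ) * half) ≡
       B J M S + ((J * J - J + fromℕ 2) * quarter + (fromℕ 2 - J) * M * half) + M * (M + 1ℚ) * half
  identity = solve-∀ ℚ-ring

module _ (j m : ℕ) (m≤j : m ≤ j) where

  private
    k = suc j
    K = fromℕ k
    J = fromℕ j
    M = fromℕ m
    e = weight k m
    weight-pred : weight j m ≡ (M - K) * e
    weight-pred = sym (weight-top j m m≤j)

  S-coefficient : 0ℚ + (M - K) * e ≡ weight j m
  S-coefficient = trans (ℚₚ.+-identityˡ _) (weight-top j m m≤j)

  entry-coefficientα : fromℕ (triangle k) * 0ℚ + (weight j m * triangleℚ M + K * 0ℚ) ≡ (M - K) * (e * triangleℚ M)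
  entry-coefficientα = trans (cong (λ w → fromℕ (triangle k) * 0ℚ + (w * triangleℚ M + K * 0ℚ)) weight-pred)
                             (identity (fromℕ (triangle k)) K (triangleℚ M) (M - K) e)
    where
    identity : ∀ c K t d e → c * 0ℚ + (d * e * t + K * 0ℚ) ≡ d * (e * t)
    identity = solve-∀ ℚ-ring

  entry-coefficientβ : fromℕ (triangle k) * e + (weight j m * entryPoly J M + K * weight j m) ≡
                       e * triangleℚ M + (M - K) * (e * entryPoly K M)
  entry-coefficientβ = trans (cong₂ (λ c w → c * e + (w * entryPoly J M + K * w)) (triangle-ℚ k) weight-pred)
                             (entryPoly-step J M e (fromℕ-suc j))

  sumelements-coefficientα : a j m + weight j m * triangleℚ M ≡ (M - K) * a k m
  sumelements-coefficientα = begin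
    a j m + weight j m * t                              ≡⟨ cong (_+ weight j m * t) (a-weight j m m≤j) ⟩
    weight j m * ((J - M) * t) + weight j m * t         ≡⟨ cong (λ w → w * ((J - M) * t) + w * t) weight-pred ⟩
    (M - K) * e * ((J - M) * t) + (M - K) * e * t       ≡⟨ identity J M t e (fromℕ-suc j) ⟩
    (M - K) * (e * ((K - M) * t))                       ≡⟨ cong ((M - K) *_) (a-weight k m (ℕₚ.m≤n⇒m≤1+n m≤j)) ⟨
    (M - K) * a k m                                     ∎
    where
    t = triangleℚ M
    identity : ∀ J {K} M t e → K ≡ 1ℚ + J → (M - K) * e * ((J - M) * t) + (M - K) * e * t ≡ (M - K) * (e * ((K - M) * t))
    identity J M t e refl = core J M t e
      where
      core : ∀ J M t e → (M - (1ℚ + J)) * e * ((J - M) * t) + (M - (1ℚ + J)) * e * t ≡ (M - (1ℚ + J)) * (e * (((1ℚ + J) - M) * t))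
      core = solve-∀ ℚ-ring

  sumelements-coefficientβ : b j m + weight j m * entryPoly J M ≡ a k m + (M - K) * b k m
  sumelements-coefficientβ = begin
    b j m + weight j m * E                                ≡⟨ cong (_+ weight j m * E) (b-weight j m) ⟩
    weight j m * B + weight j m * E                       ≡⟨ cong (λ w → w * B + w * E) weight-pred ⟩
    (M - K) * e * B + (M - K) * e * E                     ≡⟨ identity M K e B E t ⟩
    e * ((K - M) * t) + (M - K) * (e * (B + E + t))       ≡⟨ cong₂ (λ x y → x + (M - K) * (e * y))
                                                               (a-weight k m (ℕₚ.m≤n⇒m≤1+n m≤j)) (bPoly-step J M (pairSum j) (fromℕ-suc j)) ⟨
    a k m + (M - K) * (e * bPoly K M (pairSum k))         ≡⟨ cong (λ x → a k m + (M - K) * x) (b-weight k m) ⟨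
    a k m + (M - K) * b k m                               ∎
    where
    B = bPoly J M (pairSum j)
    E = entryPoly J M
    t = triangleℚ M
    identity : ∀ M K e B E t → (M - K) * e * B + (M - K) * e * E ≡ e * ((K - M) * t) + (M - K) * (e * (B + E + t))
    identity = solve-∀ ℚ-ring

entryα entryβ : ℕ → ℕ → ℚ
entryα k m = weight k m * triangleℚ (fromℕ m)
entryβ k m = weight k m * entryPoly (fromℕ k) (fromℕ m)

S-initial : ∀ j → fromℕ (S 0 j) ≡ sum1 (suc j) (weight (suc j))
S-initial zero    = refl
S-initial (suc i) = sym (trans (sum1-cong (suc (suc i)) (λ m _ _ → sym (ℚₚ.*-identityʳ _)))
                               (weighted-vanishes (suc (suc i)) (λ _ → 1ℚ) (s≤s (s≤s z≤n)) (λ _ → refl)))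

-- For k ≤ 3 these are checked by evaluation; for k ≥ 4 the polynomial has degree below k - 1.
entrySum-initial : ∀ j → fromℕ (triangle (suc j)) * fromℕ (S 0 (suc j)) + (fromℕ (entrySum 0 j) + fromℕ (suc j) * fromℕ (S 0 j))
                         ≡ sum1 (suc j) (entryβ (suc j))
entrySum-initial 0 = refl
entrySum-initial 1 = refl
entrySum-initial 2 = refl
entrySum-initial (suc (suc (suc i))) = begin
  c * 0ℚ + (0ℚ + K * 0ℚ)  ≡⟨ absorb c K ⟩
  0ℚ                      ≡⟨ weighted-vanishes (suc (suc (suc (suc i)))) _ (s≤s (s≤s (s≤s (s≤s z≤n))))
                               (quadratic-DegreeBelow ((K * K - K + fromℕ 2) * quarter) ((fromℕ 2 - K) * half) 0ℚ (λ m → linear K (fromℕ m))) ⟨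
  sum1 (suc (suc (suc (suc i)))) (entryβ (suc (suc (suc (suc i))))) ∎
  where
  c = fromℕ (triangle (suc (suc (suc (suc i)))))
  K = fromℕ (suc (suc (suc (suc i))))
  absorb : ∀ c K → c * 0ℚ + (0ℚ + K * 0ℚ) ≡ 0ℚ
  absorb = solve-∀ ℚ-ring
  linear : ∀ K M → (K * K - K + fromℕ 2) * quarter + (fromℕ 2 - K) * M * half ≡
                   (K * K - K + fromℕ 2) * quarter + (fromℕ 2 - K) * half * M + 0ℚ * (M * M)
  linear = solve-∀ ℚ-ring

sumelementsSum-initial : ∀ j → fromℕ (sumelementsSum 0 j) + fromℕ (entrySum 0 j) ≡ sum1 (suc j) (b (suc j))
sumelementsSum-initial 0 = refl
sumelementsSum-initial 1 = refl
sumelementsSum-initial 2 = refl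
sumelementsSum-initial (suc (suc (suc i))) = sym (begin
  sum1 k (b k)                                           ≡⟨ sum1-cong k (λ m _ _ → b-weight k m) ⟩
  weighted k (λ m → bPoly K (fromℕ m) (pairSum k))       ≡⟨ weighted-vanishes k _ (s≤s (s≤s (s≤s (s≤s z≤n))))
                                                              (quadratic-DegreeBelow c₀ c₁ c₂ (λ m → quadratic K (fromℕ m) (pairSum k))) ⟩
  0ℚ                                                     ∎)
  where
  k = suc (suc (suc (suc i)))
  K = fromℕ k
  c₀ = pairSum k - K * K * K * (+ 1 ℚ./ 12) - K * K * quarter + fromℕ 5 * K * (+ 1 ℚ./ 6)
  c₁ = fromℕ 7 * K * quarter - K * K * quarter - 1ℚ
  c₂ = (K - fromℕ 3) * half
  quadratic : ∀ K M S →
    - (K * (K * (K * 1ℚ)) * (+ 1 ℚ./ 12)) - (K * (K * 1ℚ) * (M + 1ℚ) * (+ 1 ℚ./ 4))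
      + (K * (fromℕ 6 * (M * (M * 1ℚ)) + fromℕ 21 * M + fromℕ 10) * (+ 1 ℚ./ 12))
      - (fromℕ 3 * (M * (M * 1ℚ)) * half) - M + S ≡
    (S - K * K * K * (+ 1 ℚ./ 12) - K * K * quarter + fromℕ 5 * K * (+ 1 ℚ./ 6))
      + (fromℕ 7 * K * quarter - K * K * quarter - 1ℚ) * M + (K - fromℕ 3) * half * (M * M)
  quadratic = solve-∀ ℚ-ring

S-closed : ∀ k n → fromℕ (S (suc n) k) ≡ partialFractions k (λ _ → 0ℚ) (weight k) (suc n)
S-closed zero    n = cong fromℕ (ΣP-no-blocks n (λ _ → 1))
S-closed (suc j) n = recurrence-partialFractions K k (λ _ → 0ℚ) (weight k) refl recurrence (S-initial j) step (suc n)
  where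
  k = suc j
  K = fromℕ k
  α′ = stepα K (λ _ → 0ℚ)
  β′ = stepβ K (λ _ → 0ℚ) (weight k)
  recurrence : ∀ n → fromℕ (S (suc n) k) ≡ K * fromℕ (S n k) + fromℕ (S n j)
  recurrence n = trans (cong fromℕ (S-suc n j)) (fromℕ-*-+ k (S n k) (S n j))
  vanish : ∀ K e → 0ℚ + (K - K) * e ≡ 0ℚ
  vanish = solve-∀ ℚ-ring
  step : ∀ n → fromℕ (S (suc n) j) ≡ partialFractions k α′ β′ (suc n)
  step n = begin
    fromℕ (S (suc n) j)                              ≡⟨ S-closed j n ⟩
    partialFractions j (λ _ → 0ℚ) (weight j) (suc n) ≡⟨ partialFractions-cong j (suc n) (λ m _ _ → sym (ℚₚ.*-zeroʳ (fromℕ m - K)))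
                                                                                   (λ m _ m≤j → sym (S-coefficient j m m≤j)) ⟩
    partialFractions j α′ β′ (suc n)                  ≡⟨ partialFractions-extend j α′ β′ (suc n) (ℚₚ.*-zeroʳ (K - K)) (vanish K (weight k k)) ⟨
    partialFractions k α′ β′ (suc n)                  ∎

entrySum-closed : ∀ k n → fromℕ (entrySum (suc n) k) ≡ partialFractions k (entryα k) (entryβ k) (suc n)
entrySum-closed zero    n = cong fromℕ (ΣP-no-blocks n sum)
  where open import Data.Nat.ListAction using (sum)
entrySum-closed (suc j) n = recurrence-partialFractions K k (entryα k) (entryβ k) refl recurrence (entrySum-initial j) step (suc n)
  where
  k = suc j
  K = fromℕ k
  c = fromℕ (triangle k)
  α′ = stepα K (entryα k)
  β′ = stepβ K (entryα k) (entryβ k)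
  w : ℕ → ℚ
  w n = c * fromℕ (S n k) + (fromℕ (entrySum n j) + K * fromℕ (S n j))
  recurrence : ∀ n → fromℕ (entrySum (suc n) k) ≡ K * fromℕ (entrySum n k) + w n
  recurrence n = begin
    fromℕ (entrySum (suc n) k)
      ≡⟨ cong fromℕ (entrySum-suc n j) ⟩
    fromℕ (k ℕ.* entrySum n k ℕ.+ (triangle k ℕ.* S n k ℕ.+ (entrySum n j ℕ.+ k ℕ.* S n j)))
      ≡⟨ fromℕ-*-+ k (entrySum n k) _ ⟩
    K * fromℕ (entrySum n k) + fromℕ (triangle k ℕ.* S n k ℕ.+ (entrySum n j ℕ.+ k ℕ.* S n j))
      ≡⟨ cong (λ x → K * fromℕ (entrySum n k) + x)
              (trans (fromℕ-*-+ (triangle k) (S n k) _)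
                     (cong (λ x → c * fromℕ (S n k) + x) (trans (fromℕ-+ (entrySum n j) _)
                                                               (cong (λ x → fromℕ (entrySum n j) + x) (fromℕ-* k (S n j)))))) ⟩
    K * fromℕ (entrySum n k) + w n ∎
  step : ∀ n → w (suc n) ≡ partialFractions k α′ β′ (suc n)
  step n = begin
    w (suc n)
      ≡⟨ cong₂ (λ x y → c * x + y) (S-closed k n) (cong₂ (λ x y → x + K * y) (entrySum-closed j n) (S-closed j n)) ⟩
    c * partialFractions k (λ _ → 0ℚ) (weight k) N + (Tj + K * partialFractions j (λ _ → 0ℚ) (weight j) N)
      ≡⟨ cong₂ (λ x y → x + (Tj + y)) (partialFractions-*ˡ k c (λ _ → 0ℚ) (weight k) N) (partialFractions-*ˡ j K (λ _ → 0ℚ) (weight j) N) ⟩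
    partialFractions k (λ _ → c * 0ℚ) (λ m → c * weight k m) N + (Tj + Sj)
      ≡⟨ regroup (partialFractions j (λ _ → c * 0ℚ) (λ m → c * weight k m) N) (c * 0ℚ * A + c * weight k k * B) Tj Sj ⟩
    (partialFractions j (λ _ → c * 0ℚ) (λ m → c * weight k m) N + (Tj + Sj)) + (c * 0ℚ * A + c * weight k k * B)
      ≡⟨ cong₂ _+_ (trans (cong (λ x → partialFractions j (λ _ → c * 0ℚ) (λ m → c * weight k m) N + x)
                                (partialFractions-+ j (entryα j) (entryβ j) (λ _ → K * 0ℚ) (λ m → K * weight j m) N))
                          (partialFractions-+ j (λ _ → c * 0ℚ) (λ m → c * weight k m)
                                              (λ m → entryα j m + K * 0ℚ) (λ m → entryβ j m + K * weight j m) N))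
                   (cong (λ t → t * 0ℚ * A + t * weight k k * B) (triangle-ℚ k)) ⟩
    partialFractions j (λ m → c * 0ℚ + (entryα j m + K * 0ℚ)) (λ m → c * weight k m + (entryβ j m + K * weight j m)) N
      + (triangleℚ K * 0ℚ * A + triangleℚ K * weight k k * B)
      ≡⟨ cong₂ _+_ (partialFractions-cong j N (λ m _ m≤j → entry-coefficientα j m m≤j) (λ m _ m≤j → entry-coefficientβ j m m≤j))
                   (last-term (triangleℚ K) K (weight k k) (entryPoly K K) A B) ⟩
    partialFractions k α′ β′ N ∎
    where
    N = suc n
    A = invYminusSq k N
    B = invYminus k N
    Tj = partialFractions j (entryα j) (entryβ j) N
    Sj = partialFractions j (λ _ → K * 0ℚ) (λ m → K * weight j m) N
    regroup : ∀ x l y z → (x + l) + (y + z) ≡ (x + (y + z)) + l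
    regroup = solve-∀ ℚ-ring
    last-term : ∀ t K e p A B → t * 0ℚ * A + t * e * B ≡ (K - K) * (e * t) * A + (e * t + (K - K) * (e * p)) * B
    last-term = solve-∀ ℚ-ring

sumelementsSum-closed : ∀ k n → fromℕ (sumelementsSum (suc n) k) ≡ partialFractions k (a k) (b k) (suc n)
sumelementsSum-closed zero    n = cong fromℕ (ΣP-no-blocks n (sumelements 0))
sumelementsSum-closed (suc j) n = recurrence-partialFractions K k (a k) (b k) refl recurrence (sumelementsSum-initial j) step (suc n)
  where
  k = suc j
  K = fromℕ k
  α′ = stepα K (a k)
  β′ = stepβ K (a k) (b k)
  w : ℕ → ℚ
  w n = fromℕ (sumelementsSum n j) + fromℕ (entrySum n j)
  recurrence : ∀ n → fromℕ (sumelementsSum (suc n) k) ≡ K * fromℕ (sumelementsSum n k) + w n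
  recurrence n = trans (cong fromℕ (sumelementsSum-suc n j))
                       (trans (fromℕ-*-+ k (sumelementsSum n k) (sumelementsSum n j ℕ.+ entrySum n j))
                              (cong (λ x → K * fromℕ (sumelementsSum n k) + x) (fromℕ-+ (sumelementsSum n j) (entrySum n j))))
  step : ∀ n → w (suc n) ≡ partialFractions k α′ β′ (suc n)
  step n = begin
    w (suc n)
      ≡⟨ cong₂ _+_ (sumelementsSum-closed j n) (entrySum-closed j n) ⟩
    partialFractions j (a j) (b j) N + partialFractions j (entryα j) (entryβ j) N
      ≡⟨ partialFractions-+ j (a j) (b j) (entryα j) (entryβ j) N ⟩
    partialFractions j (λ m → a j m + entryα j m) (λ m → b j m + entryβ j m) N
      ≡⟨ partialFractions-cong j N (λ m _ m≤j → sumelements-coefficientα j m m≤j) (λ m _ m≤j → sumelements-coefficientβ j m m≤j) ⟩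
    partialFractions j α′ β′ N
      ≡⟨ partialFractions-extend j α′ β′ N (trans (cong ((K - K) *_) (a-diagonal k)) (ℚₚ.*-zeroʳ (K - K)))
                                            (trans (cong₂ (λ x y → x + (K - K) * y) (a-diagonal k) refl) (cancel K (b k k))) ⟨
    partialFractions k α′ β′ N ∎
    where
    N = suc n
    cancel : ∀ K x → 0ℚ + (K - K) * x ≡ 0ℚ
    cancel = solve-∀ ℚ-ring

proposition1 : (k : ℕ) → k ≥ 1 → (n : ℕ) → D k n ≡ RHS k n
proposition1 (suc j) _ zero    = sym (trans (RHS-partialFractions (suc j) 0) (partialFractions-0 (suc j) (a (suc j)) (b (suc j))))
proposition1 (suc j) _ (suc n) = begin
  D k (suc n)                              ≡⟨ D-ΣP k (suc n) ⟩
  fromℕ (sumelementsSum (suc n) k)         ≡⟨ sumelementsSum-closed k n ⟩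
  partialFractions k (a k) (b k) (suc n)   ≡⟨ RHS-partialFractions k (suc n) ⟨
  RHS k (suc n)                            ∎
  where k = suc j
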